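{- Let $k\ge 3$ and let $G$ be a mixed $k$-melon graph whose set of paths $\mathcal{P}=\mathcal{P}_{even}\cup\mathcal{P}_{odd}$ satisfies $|\mathcal{P}_{odd}|=1$, say $\mathcal{P}_{odd}=\{P_o\}$. For $x\in\{s,t\}$ and $P_e\in\mathcal{P}_{even}$ let $U^{x}_{P_e}$ be the vertex set such that $P_e$ is external, every path of $\mathcal{P}_{even}\setminus\{P_e\}$ is internal, and $P_o$ is an $x$-path, all with respect to $U^{x}_{P_e}$. Then $\mathrm{evc}(G)=\mathrm{vc}(G)+1$, and $\mathcal{U}=\{U^{x}_{P_e} : x\in\{s,t\},\ P_e\in\mathcal{P}_{even}\}$ is a minimum eternal vertex cover class of $G$.
   Context: For $k\ge1$, a $k$-melon graph is the union of a set $\mathcal{P}$ of $k$ pairwise internally vertex-disjoint paths, each of length at least $1$, with the same two distinct endpoints $s$ and $t$. $\mathcal{P}_{even}$ and $\mathcal{P}_{odd}$ are the paths of even and odd length; $G$ is mixed if both are nonempty. For an even path $P$ with vertices $v_0,\dots,v_{2m}$, $\{v_0,v_{2m}\}=\{s,t\}$, and a vertex set $U$: $P$ is internal w.r.t. $U$ if $U\cap V(P)=\{v_{2j}:0\le j\le m\}$, external if $U\cap V(P)=\{v_{2j+1}:0\le j\le m-1\}\cup\{s,t\}$. For an odd path $P_o$ with vertices $v_0=t,\dots,v_{2m+1}=s$: $P_o$ is an $s$-path w.r.t. $U$ if $(U\cap V(P_o))\setminus\{t\}=\{v_{2i+1}:0\le i\le m\}$, a $t$-path if $(U\cap V(P_o))\setminus\{s\}=\{v_{2i}:0\le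 i\le m\}$. $\mathrm{vc}(G)$ is the vertex cover number. For a vertex cover $U$ of $G=(V,E)$ and an edge $e=vw$, a defense of $U$ against $e$ is a one-to-one map $\phi:U\to V$ with $\phi(u)\in N[u]$ (closed neighborhood) for all $u\in U$ and $\phi(v)=w$ (with $v\in U$) or $\phi(w)=v$ (with $w\in U$). An eternal vertex cover class is a family $\mathcal{U}$ of vertex covers of equal cardinality (its size) such that for every $U\in\mathcal{U}$ and every edge $e$ there is a defense $\phi$ of $U$ against $e$ with $\phi(U)\in\mathcal{U}$; $\mathrm{evc}(G)$ is the minimum size of such a class, and a class of that size is minimum. -}

module Defs where

open import Data.Nat using (ℕ; zero; suc; _+_; _≤_; _<_; _<?_; pred)
open import Data.Fin using (Fin; fromℕ<)
open import Data.Bool using (Bool; true; false; if_then_else_)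
open import Data.List using (List; []; _∷_; map; concatMap; allFin)
open import Data.Product using (Σ; _×_; ∃; _,_)
open import Data.Sum using (_⊎_)
open import Relation.Binary.PropositionalEquality using (_≡_; _≢_)
open import Relation.Nullary using (yes; no)
open import Function.Bundles using (_⇔_)
open import Level using () renaming (suc to lsuc; zero to lzero)

Even : ℕ → Set
Even n = Σ ℕ λ m → n ≡ m + m

Odd : ℕ → Set
Odd n = Σ ℕ λ m → n ≡ suc (m + m)

-- Finite graphs, given by a vertex type, a (duplicate-free, complete)
-- enumeration of the vertices, and an adjacency relation.

record Graph : Set₁ where
  field
    V        : Set
    vertices : List V
    Adj      : V → V → Set
open Graph public

VSet : Graph → Set
VSet G = V G → Bool

_∈ₛ_ : {G : Graph} → V G → VSet G → Set
v ∈ₛ U = U v ≡ true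

count : {A : Set} → (A → Bool) → List A → ℕ
count U []       = 0
count U (x ∷ xs) = if U x then suc (count U xs) else count U xs

card : (G : Graph) → VSet G → ℕ
card G U = count U (vertices G)

IsVertexCover : (G : Graph) → VSet G → Set
IsVertexCover G U = ∀ v w → Adj G v w → (U v ≡ true) ⊎ (U w ≡ true)

IsVCNumber : Graph → ℕ → Set
IsVCNumber G c =
  (Σ (VSet G) λ U → IsVertexCover G U × card G U ≡ c) ×
  (∀ U → IsVertexCover G U → c ≤ card G U)

InClosedNbhd : (G : Graph) → V G → V G → Set
InClosedNbhd G u x = (x ≡ u) ⊎ Adj G u x

-- φ : U → V (given as a total function, only its values on U matter)
-- is a defense of U against the edge vw
IsDefense : (G : Graph) → VSet G → (V G → V G) → V G → V G → Set
IsDefense G U φ v w =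
  (∀ u u' → U u ≡ true → U u' ≡ true → φ u ≡ φ u' → u ≡ u') ×
  (∀ u → U u ≡ true → InClosedNbhd G u (φ u)) ×
  ((U v ≡ true × φ v ≡ w) ⊎ (U w ≡ true × φ w ≡ v))

IsImage : (G : Graph) → VSet G → (V G → V G) → VSet G → Set
IsImage G U φ W = ∀ y → (W y ≡ true) ⇔ (Σ (V G) λ u → U u ≡ true × φ u ≡ y)

Family : Graph → Set₁
Family G = VSet G → Set

IsEVCClass : (G : Graph) → Family G → ℕ → Set
IsEVCClass G 𝒰 m =
  (Σ (VSet G) 𝒰) ×
  (∀ U → 𝒰 U → IsVertexCover G U × card G U ≡ m) ×
  (∀ U → 𝒰 U → ∀ v w → Adj G v w →
     Σ (V G → V G) λ φ → IsDefense G U φ v w ×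
       Σ (VSet G) λ W → 𝒰 W × IsImage G U φ W)

IsEVCNumber : Graph → ℕ → Set₁
IsEVCNumber G m =
  (Σ (Family G) λ 𝒰 → IsEVCClass G 𝒰 m) ×
  (∀ m' (𝒰 : Family G) → IsEVCClass G 𝒰 m' → m ≤ m')

-- k-melon graph with path lengths ℓ : Fin k → ℕ.
-- Every path i is v₀ = t, v₁, …, v_{ℓ i} = s; the internal vertex at
-- position suc j (j < ℓ i - 1) of path i is  inn i j.

data MV (k : ℕ) (ℓ : Fin k → ℕ) : Set where
  S T : MV k ℓ
  inn : (i : Fin k) → Fin (pred (ℓ i)) → MV k ℓ

-- vertex at position p of path i (meaningful for p ≤ ℓ i)
at : (k : ℕ) (ℓ : Fin k → ℕ) → Fin k → ℕ → MV k ℓ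
at k ℓ i zero = T
at k ℓ i (suc p) with p <? pred (ℓ i)
... | yes h = inn i (fromℕ< h)
... | no _  = S

melonAdj : (k : ℕ) (ℓ : Fin k → ℕ) → MV k ℓ → MV k ℓ → Set
melonAdj k ℓ u v = Σ (Fin k) λ i → Σ ℕ λ p → p < ℓ i ×
  ((u ≡ at k ℓ i p × v ≡ at k ℓ i (suc p)) ⊎
   (v ≡ at k ℓ i p × u ≡ at k ℓ i (suc p)))

melon : (k : ℕ) → (Fin k → ℕ) → Graph
melon k ℓ = record
  { V = MV k ℓ
  ; vertices = S ∷ T ∷ concatMap (λ i → map (inn i) (allFin (pred (ℓ i)))) (allFin k)
  ; Adj = melonAdj k ℓ
  }

module _ (k : ℕ) (ℓ : Fin k → ℕ) where
  private G = melon k ℓ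

  Internal : Fin k → VSet G → Set
  Internal i U = ∀ p → p ≤ ℓ i → (U (at k ℓ i p) ≡ true) ⇔ Even p

  External : Fin k → VSet G → Set
  External i U = ∀ p → p ≤ ℓ i →
    (U (at k ℓ i p) ≡ true) ⇔ (Odd p ⊎ (p ≡ 0 ⊎ p ≡ ℓ i))

  SPath : Fin k → VSet G → Set
  SPath i U = ∀ p → p ≤ ℓ i → p ≢ 0 → (U (at k ℓ i p) ≡ true) ⇔ Odd p

  TPath : Fin k → VSet G → Set
  TPath i U = ∀ p → p ≤ ℓ i → p ≢ ℓ i → (U (at k ℓ i p) ≡ true) ⇔ Even p

  data End : Set where
    s t : End

  XPath : End → Fin k → VSet G → Set
  XPath s = SPath
  XPath t = TPath

  IsUxPe : (o : Fin k) → End → Fin k → VSet G → Set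
  IsUxPe o x e U =
    External e U × (∀ i → i ≢ o → i ≢ e → Internal i U) × XPath x o U

  𝒰fam : (o : Fin k) → Family G
  𝒰fam o U = Σ End λ x → Σ (Fin k) λ e → e ≢ o × IsUxPe o x e U

-- Count path by path. A vertex cover containing both ends s = S and t = T needs at least
-- ⌊(ℓᵢ - 1)/2⌋ interior vertices on path i, and the even positions attain this, so
-- vc = 2 + Σᵢ ⌊(ℓᵢ - 1)/2⌋. A cover missing an end needs one interior vertex more on every
-- even path, k - 1 ≥ 2 more in all, and a cover containing the neighbour of t on an even path
-- needs one more on that path; either way it has at least vc + 1 vertices. Defending the edge
-- from t to that neighbour puts a guard on the neighbour before or after the move, so
-- evc ≥ vc + 1. Conversely every U^x_{P_e} has vc + 1 vertices, and each attack on it is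
-- repelled by shifting all guards of at most three paths one step along their paths, the
-- guards on s and t stepping onto adjacent paths; such a shift is a bijection onto another
-- member of 𝒰 because the opposite shift undoes it.

module Submission where

open import Defs
open import Data.Bool using (Bool; true; false; not)
open import Data.Bool.Properties using (not-involutive; not-injective; not-¬)
open import Data.Empty using (⊥-elim)
open import Data.Fin using (Fin; zero; suc; toℕ; fromℕ<; punchIn; punchOut; _≟_)
open import Data.Fin.Properties using (toℕ<n; toℕ-fromℕ<; toℕ-injective; punchInᵢ≢i; punchIn-injective; punchIn-punchOut; suc-injective)
open import Data.List using (List; []; _∷_; _++_; map; concatMap; tabulate; allFin)
open import Data.List.Properties using (map-tabulate)
open import Data.List.Membership.Propositional using (_∈_)
open import Data.List.Relation.Unary.Any using (here; there)
open import Data.List.Relation.Unary.All using (All; []; _∷_)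
open import Data.Nat using (ℕ; zero; suc; _<?_; >-nonZero; s≤s⁻¹; _+_; _≤_; _<_; z≤n; s≤s; pred; ⌊_/2⌋; ⌈_/2⌉)
open import Data.Nat.Properties hiding (_≟_; suc-injective)
open import Algebra.Properties.Monoid.Sum +-0-monoid using (sum; sum-cong-≗)
open import Data.Nat.Tactic.RingSolver using (solve-∀)
open import Data.Product using (Σ; ∃; _×_; _,_; proj₁; proj₂; map₁)
open import Data.Sum using (_⊎_; inj₁; inj₂)
import Data.Sum as Sum
open import Function using (_∘_; id)
open import Data.Vec.Functional using (updateAt)
open import Data.Vec.Functional.Properties using (updateAt-updates; updateAt-minimal)
open import Function.Bundles using (_⇔_; mk⇔; Equivalence)
open import Function.Properties.Equivalence using () renaming (trans to ⇔-trans)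
open import Relation.Binary.PropositionalEquality
open import Relation.Binary.Definitions using (DecidableEquality)
open import Relation.Nullary using (yes; no)

_[_]≔_ : ∀ {A : Set} {n} → (Fin n → A) → Fin n → A → Fin n → A
xs [ i ]≔ x = updateAt xs i (λ _ → x)

[]≔-updates : ∀ {A : Set} {n} (xs : Fin n → A) i {x} → (xs [ i ]≔ x) i ≡ x
[]≔-updates xs i = updateAt-updates i xs

[]≔-minimal : ∀ {A : Set} {n} (xs : Fin n → A) {i j x} → j ≢ i → (xs [ i ]≔ x) j ≡ xs j
[]≔-minimal xs j≢i = updateAt-minimal _ _ xs j≢i

[]≔-inv : ∀ {A : Set} {n} (xs : Fin n → A) i {x y} j → (xs [ i ]≔ x) j ≡ y → (j ≡ i × x ≡ y) ⊎ xs j ≡ y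
[]≔-inv xs i j eq with j ≟ i
... | yes refl = inj₁ (refl , trans (sym ([]≔-updates xs i)) eq)
... | no j≢i   = inj₂ (trans (sym ([]≔-minimal xs j≢i)) eq)

avoid-two : ∀ {n} → 3 ≤ n → (x y : Fin n) → ∃ λ a → a ≢ x × a ≢ y
avoid-two {suc (suc (suc n))} (s≤s (s≤s (s≤s z≤n))) x y with y ≟ x
... | yes refl = punchIn x zero , punchInᵢ≢i x zero , punchInᵢ≢i x zero
... | no y≢x   = a , punchInᵢ≢i x j , a≢y
  where
  y′ = punchOut (y≢x ∘ sym)
  j  = punchIn y′ zero
  a  = punchIn x j
  a≢y : a ≢ y
  a≢y a≡y = punchInᵢ≢i y′ zero (punchIn-injective x j y′ (trans a≡y (sym (punchIn-punchOut (y≢x ∘ sym)))))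

alt : Bool → ℕ → Bool
alt b zero    = b
alt b (suc p) = alt (not b) p

alt-suc : ∀ b p → alt b (suc p) ≡ not (alt b p)
alt-suc b zero    = refl
alt-suc b (suc p) = alt-suc (not b) p

alt-even : ∀ b {p} → Even p → alt b p ≡ b
alt-even b (zero , refl)  = refl
alt-even b (suc m , refl) rewrite +-suc m m =
  trans (alt-even (not (not b)) (m , refl)) (not-involutive b)

alt-odd : ∀ b {p} → Odd p → alt b p ≡ not b
alt-odd b (m , refl) = alt-even (not b) (m , refl)

even⊎odd : ∀ p → Even p ⊎ Odd p
even⊎odd zero = inj₁ (0 , refl)
even⊎odd (suc p) with even⊎odd p
... | inj₁ (m , refl) = inj₂ (m , refl)
... | inj₂ (m , refl) = inj₁ (suc m , cong suc (sym (+-suc m m)))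

alt-true⇔even : ∀ p → (alt true p ≡ true) ⇔ Even p
alt-true⇔even p = mk⇔ to (λ ev → alt-even true ev)
  where
  to : alt true p ≡ true → Even p
  to h with even⊎odd p
  ... | inj₁ ev = ev
  ... | inj₂ od = ⊥-elim (not-¬ refl (trans (sym h) (alt-odd true od)))

alt-false⇔odd : ∀ p → (alt false p ≡ true) ⇔ Odd p
alt-false⇔odd p = mk⇔ to (λ od → alt-odd false od)
  where
  to : alt false p ≡ true → Odd p
  to h with even⊎odd p
  ... | inj₁ ev = ⊥-elim (not-¬ refl (trans (sym h) (alt-even false ev)))
  ... | inj₂ od = od

⇔-true-≡ : ∀ {b c : Bool} {Q : Set} → (b ≡ true) ⇔ Q → (c ≡ true) ⇔ Q → b ≡ c
⇔-true-≡ {true}  {true}  _   _   = refl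
⇔-true-≡ {false} {false} _   _   = refl
⇔-true-≡ {true}  {false} b⇔Q c⇔Q = sym (Equivalence.from c⇔Q (Equivalence.to b⇔Q refl))
⇔-true-≡ {false} {true}  b⇔Q c⇔Q = Equivalence.from b⇔Q (Equivalence.to c⇔Q refl)

⟦_⟧ : Bool → ℕ
⟦ true ⟧  = 1
⟦ false ⟧ = 0

⌊⟦b⟧/2⌋≡0 : ∀ b → ⌊ ⟦ b ⟧ /2⌋ ≡ 0
⌊⟦b⟧/2⌋≡0 true  = refl
⌊⟦b⟧/2⌋≡0 false = refl

tally : (ℕ → Bool) → ℕ → ℕ
tally f zero    = 0
tally f (suc n) = ⟦ f 0 ⟧ + tally (f ∘ suc) n

tally-alt-true : ∀ n → tally (alt true) n ≡ ⌈ n /2⌉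
tally-alt-false : ∀ n → tally (alt false) n ≡ ⌊ n /2⌋
tally-alt-true zero     = refl
tally-alt-true (suc n)  = cong suc (tally-alt-false n)
tally-alt-false zero    = refl
tally-alt-false (suc n) = tally-alt-true n

⟦a⟧+⟦b⟧≥1 : ∀ {a b} → a ≡ true ⊎ b ≡ true → 1 ≤ ⟦ a ⟧ + ⟦ b ⟧
⟦a⟧+⟦b⟧≥1 {true}           _ = s≤s z≤n
⟦a⟧+⟦b⟧≥1 {false} {true}   _ = s≤s z≤n
⟦a⟧+⟦b⟧≥1 {false} {false} (inj₁ ())
⟦a⟧+⟦b⟧≥1 {false} {false} (inj₂ ())

-- Every edge of the path 0 — 1 — ⋯ — suc n needs an endpoint in f, and an interior vertex covers two.
path-cover-bound : ∀ n (f : ℕ → Bool) → (∀ p → p ≤ n → f p ≡ true ⊎ f (suc p) ≡ true) →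
  suc n ≤ ⟦ f 0 ⟧ + ⟦ f (suc n) ⟧ + (tally (f ∘ suc) n + tally (f ∘ suc) n)
path-cover-bound zero f cover = ≤-trans (⟦a⟧+⟦b⟧≥1 (cover 0 z≤n)) (m≤m+n _ 0)
path-cover-bound (suc n) f cover = begin
  suc (suc n)                                ≤⟨ +-mono-≤ (⟦a⟧+⟦b⟧≥1 (cover 0 z≤n)) ih ⟩
  ⟦ f 0 ⟧ + ⟦ f 1 ⟧ + (⟦ f 1 ⟧ + F + (I + I)) ≡⟨ regroup ⟦ f 0 ⟧ ⟦ f 1 ⟧ F I ⟩
  ⟦ f 0 ⟧ + F + ((⟦ f 1 ⟧ + I) + (⟦ f 1 ⟧ + I)) ∎
  where
  open ≤-Reasoning
  F = ⟦ f (suc (suc n)) ⟧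
  I = tally (λ p → f (suc (suc p))) n
  ih = path-cover-bound n (f ∘ suc) (λ p p≤n → cover (suc p) (s≤s p≤n))
  regroup : ∀ a b F I → a + b + (b + F + (I + I)) ≡ a + F + ((b + I) + (b + I))
  regroup = solve-∀

⌊n+[m+m]/2⌋≡⌊n/2⌋+m : ∀ n m → ⌊ n + (m + m) /2⌋ ≡ ⌊ n /2⌋ + m
⌊n+[m+m]/2⌋≡⌊n/2⌋+m zero          m = sym (n≡⌊n+n/2⌋ m)
⌊n+[m+m]/2⌋≡⌊n/2⌋+m (suc zero)    m = sym (n≡⌈n+n/2⌉ m)
⌊n+[m+m]/2⌋≡⌊n/2⌋+m (suc (suc n)) m = cong suc (⌊n+[m+m]/2⌋≡⌊n/2⌋+m n m)

⌊n/2⌋-bound : ∀ c m {n} → n ≤ c + (m + m) → ⌊ n /2⌋ ≤ ⌊ c /2⌋ + m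
⌊n/2⌋-bound c m n≤ = ≤-trans (⌊n/2⌋-mono n≤) (≤-reflexive (⌊n+[m+m]/2⌋≡⌊n/2⌋+m c m))

⌈n/2⌉-bound : ∀ c m {n} → n ≤ c + (m + m) → ⌈ n /2⌉ ≤ ⌈ c /2⌉ + m
⌈n/2⌉-bound c m n≤ = ⌊n/2⌋-bound (suc c) m (s≤s n≤)

⌈n/2⌉≡⌊n/2⌋ : ∀ {n} → Even n → ⌈ n /2⌉ ≡ ⌊ n /2⌋
⌈n/2⌉≡⌊n/2⌋ (m , refl) = trans (sym (n≡⌈n+n/2⌉ m)) (n≡⌊n+n/2⌋ m)

⌈n/2⌉≡1+⌊n/2⌋ : ∀ {n} → Odd n → ⌈ n /2⌉ ≡ suc ⌊ n /2⌋
⌈n/2⌉≡1+⌊n/2⌋ (m , refl) = cong suc (trans (sym (n≡⌊n+n/2⌋ m)) (n≡⌈n+n/2⌉ m))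

sum-mono : ∀ {n} {f g : Fin n → ℕ} → (∀ i → f i ≤ g i) → sum f ≤ sum g
sum-mono {zero}  f≤g = z≤n
sum-mono {suc n} f≤g = +-mono-≤ (f≤g zero) (sum-mono (f≤g ∘ suc))

sum-≤-at : ∀ {n} (j : Fin n) {f g : Fin n → ℕ} {c d} →
  (∀ i → i ≢ j → f i ≤ g i) → f j + c ≤ g j + d → sum f + c ≤ sum g + d
sum-≤-at zero {f} {g} {c} {d} f≤g at-j = begin
  f zero + sum (f ∘ suc) + c   ≡⟨ +-comm-middle (f zero) (sum (f ∘ suc)) c ⟩
  f zero + c + sum (f ∘ suc)   ≤⟨ +-mono-≤ at-j (sum-mono (λ i → f≤g (suc i) λ ())) ⟩
  g zero + d + sum (g ∘ suc)   ≡⟨ +-comm-middle (g zero) d (sum (g ∘ suc)) ⟩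
  g zero + sum (g ∘ suc) + d   ∎
  where
  open ≤-Reasoning
  +-comm-middle : ∀ a b c → a + b + c ≡ a + c + b
  +-comm-middle = solve-∀
sum-≤-at (suc j) {f} {g} {c} {d} f≤g at-j = begin
  f zero + sum (f ∘ suc) + c   ≡⟨ +-assoc (f zero) _ c ⟩
  f zero + (sum (f ∘ suc) + c) ≤⟨ +-mono-≤ (f≤g zero λ ()) (sum-≤-at j (λ i → f≤g (suc i) ∘ (_∘ suc-injective)) at-j) ⟩
  g zero + (sum (g ∘ suc) + d) ≡⟨ +-assoc (g zero) _ d ⟨
  g zero + sum (g ∘ suc) + d   ∎
  where open ≤-Reasoning

sum-≡-at : ∀ {n} (j : Fin n) {f g : Fin n → ℕ} {c d} →
  (∀ i → i ≢ j → f i ≡ g i) → f j + c ≡ g j + d → sum f + c ≡ sum g + d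
sum-≡-at j f≡g at-j = ≤-antisym
  (sum-≤-at j (λ i i≢j → ≤-reflexive (f≡g i i≢j)) (≤-reflexive at-j))
  (sum-≤-at j (λ i i≢j → ≤-reflexive (sym (f≡g i i≢j))) (≤-reflexive (sym at-j)))

sum-suc : ∀ {n} (f : Fin n → ℕ) → sum (suc ∘ f) ≡ n + sum f
sum-suc {zero}  f = refl
sum-suc {suc n} f = cong suc (trans (cong (f zero +_) (sum-suc (f ∘ suc))) (+-comm-left (f zero) n _))
  where
  +-comm-left : ∀ a b c → a + (b + c) ≡ b + (a + c)
  +-comm-left = solve-∀

module _ {A : Set} (P : A → Bool) where

  count-∷ : ∀ x xs → count P (x ∷ xs) ≡ ⟦ P x ⟧ + count P xs
  count-∷ x xs with P x
  ... | true  = refl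
  ... | false = refl

  count-++ : ∀ xs ys → count P (xs ++ ys) ≡ count P xs + count P ys
  count-++ []       ys = refl
  count-++ (x ∷ xs) ys = begin
    count P (x ∷ xs ++ ys)               ≡⟨ count-∷ x (xs ++ ys) ⟩
    ⟦ P x ⟧ + count P (xs ++ ys)         ≡⟨ cong (⟦ P x ⟧ +_) (count-++ xs ys) ⟩
    ⟦ P x ⟧ + (count P xs + count P ys)  ≡⟨ +-assoc ⟦ P x ⟧ _ _ ⟨
    ⟦ P x ⟧ + count P xs + count P ys    ≡⟨ cong (_+ count P ys) (count-∷ x xs) ⟨
    count P (x ∷ xs) + count P ys        ∎
    where open ≡-Reasoning

  count-concatMap-tabulate : ∀ {B : Set} n (g : Fin n → B) (F : B → List A) →
    count P (concatMap F (tabulate g)) ≡ sum (λ i → count P (F (g i)))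
  count-concatMap-tabulate zero    g F = refl
  count-concatMap-tabulate (suc n) g F =
    trans (count-++ (F (g zero)) _) (cong (count P (F (g zero)) +_) (count-concatMap-tabulate n (g ∘ suc) F))

  count-tabulate : ∀ n (g : Fin n → A) (h : ℕ → Bool) →
    (∀ j → P (g j) ≡ h (toℕ j)) → count P (tabulate g) ≡ tally h n
  count-tabulate zero    g h P∘g≡h = refl
  count-tabulate (suc n) g h P∘g≡h = trans (count-∷ (g zero) (tabulate (g ∘ suc)))
    (cong₂ _+_ (cong ⟦_⟧ (P∘g≡h zero)) (count-tabulate n (g ∘ suc) (h ∘ suc) (P∘g≡h ∘ suc)))

count-cong : ∀ {A : Set} {P Q : A → Bool} xs → (∀ x → P x ≡ Q x) → count P xs ≡ count Q xs
count-cong []       P≗Q = refl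
count-cong {P = P} {Q} (x ∷ xs) P≗Q =
  trans (count-∷ P x xs) (trans (cong₂ _+_ (cong ⟦_⟧ (P≗Q x)) (count-cong xs P≗Q)) (sym (count-∷ Q x xs)))

module _ (Γ : Graph) where

  InjectiveOn : VSet Γ → (V Γ → V Γ) → Set
  InjectiveOn U φ = ∀ u u′ → U u ≡ true → U u′ ≡ true → φ u ≡ φ u′ → u ≡ u′

  WithinReach : VSet Γ → (V Γ → V Γ) → Set
  WithinReach U φ = ∀ u → U u ≡ true → InClosedNbhd Γ u (φ u)

  Legal : VSet Γ → (V Γ → V Γ) → VSet Γ → Set
  Legal U φ W = InjectiveOn U φ × WithinReach U φ × IsImage Γ U φ W

  legal-by-inverse : ∀ {U W : VSet Γ} φ ψ → WithinReach U φ →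
    (∀ u → U u ≡ true → W (φ u) ≡ true) → (∀ w → W w ≡ true → U (ψ w) ≡ true) →
    (∀ u → U u ≡ true → ψ (φ u) ≡ u) → (∀ w → W w ≡ true → φ (ψ w) ≡ w) →
    Legal U φ W
  legal-by-inverse φ ψ reach φ∈ ψ∈ ψφ φψ =
    (λ u u′ u∈ u′∈ eq → trans (sym (ψφ u u∈)) (trans (cong ψ eq) (ψφ u′ u′∈))) ,
    reach ,
    λ w → mk⇔ (λ w∈ → ψ w , ψ∈ w w∈ , φψ w w∈) (λ { (u , u∈ , refl) → φ∈ u u∈ })

  module _ (_≟V_ : DecidableEquality (V Γ)) where

    swap : V Γ → V Γ → V Γ → V Γ
    swap v w u with u ≟V v | u ≟V w
    ... | yes _ | _     = w
    ... | no _  | yes _ = v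
    ... | no _  | no _  = u

    swap-at-v : ∀ v w → swap v w v ≡ w
    swap-at-v v w with v ≟V v
    ... | yes _   = refl
    ... | no v≢v  = ⊥-elim (v≢v refl)

    swap-at-w : ∀ v w → swap v w w ≡ v
    swap-at-w v w with w ≟V v | w ≟V w
    ... | yes w≡v | _      = w≡v
    ... | no _    | yes _  = refl
    ... | no _    | no w≢w = ⊥-elim (w≢w refl)

    swap-involutive : ∀ v w u → swap v w (swap v w u) ≡ u
    swap-involutive v w u with u ≟V v | u ≟V w
    ... | yes refl | _        = swap-at-w u w
    ... | no _     | yes refl = swap-at-v v u
    ... | no u≢v   | no u≢w with u ≟V v | u ≟V w
    ...   | yes u≡v | _       = ⊥-elim (u≢v u≡v)
    ...   | no _    | yes u≡w = ⊥-elim (u≢w u≡w)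
    ...   | no _    | no _    = refl

    swap-legal : ∀ {U : VSet Γ} {v w} → U v ≡ true → U w ≡ true → Adj Γ v w → Adj Γ w v →
      Legal U (swap v w) U
    swap-legal {U} {v} {w} v∈ w∈ v~w w~v =
      legal-by-inverse (swap v w) (swap v w) reach stays stays
        (λ u _ → swap-involutive v w u) (λ u _ → swap-involutive v w u)
      where
      stays : ∀ u → U u ≡ true → U (swap v w u) ≡ true
      stays u u∈ with u ≟V v | u ≟V w
      ... | yes _ | _     = w∈
      ... | no _  | yes _ = v∈
      ... | no _  | no _  = u∈
      reach : WithinReach U (swap v w)
      reach u _ with u ≟V v | u ≟V w
      ... | yes refl | _        = inj₂ v~w
      ... | no _     | yes refl = inj₂ w~v
      ... | no _     | no _     = inj₁ refl

module Melon (k : ℕ) (ℓ : Fin k → ℕ) (ℓ≥1 : ∀ i → 1 ≤ ℓ i) where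

  G : Graph
  G = melon k ℓ

  Vertex : Set
  Vertex = MV k ℓ

  at′ : Fin k → ℕ → Vertex
  at′ = at k ℓ

  first last : Fin k → Vertex
  first i = at′ i 1
  last  i = at′ i (pred (ℓ i))

  suc-pred-ℓ : ∀ i → suc (pred (ℓ i)) ≡ ℓ i
  suc-pred-ℓ i = suc-pred (ℓ i) ⦃ >-nonZero (ℓ≥1 i) ⦄

  <ℓ⇒≤pred : ∀ {i p} → p < ℓ i → p ≤ pred (ℓ i)
  <ℓ⇒≤pred {i} p<ℓ = s≤s⁻¹ (subst (_ <_) (sym (suc-pred-ℓ i)) p<ℓ)

  ≤pred⇒<ℓ : ∀ {i p} → p ≤ pred (ℓ i) → p < ℓ i
  ≤pred⇒<ℓ {i} p≤ = subst (_ <_) (suc-pred-ℓ i) (s≤s p≤)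

  inn<ℓ : ∀ i (j : Fin (pred (ℓ i))) → suc (toℕ j) < ℓ i
  inn<ℓ i j = ≤pred⇒<ℓ (toℕ<n j)

  at-suc-view : ∀ i p → (∃ λ j → toℕ j ≡ p × at′ i (suc p) ≡ inn i j)
                      ⊎ (pred (ℓ i) ≤ p × at′ i (suc p) ≡ S)
  at-suc-view i p with p <? pred (ℓ i)
  ... | yes p< = inj₁ (fromℕ< p< , toℕ-fromℕ< p< , refl)
  ... | no p≮  = inj₂ (≮⇒≥ p≮ , refl)

  at-inn : ∀ i j → at′ i (suc (toℕ j)) ≡ inn i j
  at-inn i j with at-suc-view i (toℕ j)
  ... | inj₁ (j′ , j′≡j , eq) = trans eq (cong (inn i) (toℕ-injective j′≡j))
  ... | inj₂ (ℓ≤j , _)         = ⊥-elim (<⇒≱ (toℕ<n j) ℓ≤j)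

  at-S : ∀ i {p} → pred (ℓ i) ≤ p → at′ i (suc p) ≡ S
  at-S i {p} ℓ≤p with at-suc-view i p
  ... | inj₁ (j , refl , _) = ⊥-elim (<⇒≱ (toℕ<n j) ℓ≤p)
  ... | inj₂ (_ , eq)       = eq

  at-ℓ : ∀ i → at′ i (ℓ i) ≡ S
  at-ℓ i = subst (λ q → at′ i q ≡ S) (suc-pred-ℓ i) (at-S i ≤-refl)

  edge : ∀ i p → p < ℓ i → Adj G (at′ i p) (at′ i (suc p))
  edge i p p<ℓ = i , p , p<ℓ , inj₁ (refl , refl)

  edge⁻ : ∀ i p → p < ℓ i → Adj G (at′ i (suc p)) (at′ i p)
  edge⁻ i p p<ℓ = i , p , p<ℓ , inj₂ (refl , refl)

  _≟V_ : DecidableEquality Vertex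
  S ≟V S = yes refl
  T ≟V T = yes refl
  inn i j ≟V inn i′ j′ with i ≟ i′
  ... | no i≢i′  = no λ { refl → i≢i′ refl }
  ... | yes refl with j ≟ j′
  ...   | yes refl = yes refl
  ...   | no j≢j′  = no λ { refl → j≢j′ refl }
  S ≟V T       = no λ ()
  S ≟V inn _ _ = no λ ()
  T ≟V S       = no λ ()
  T ≟V inn _ _ = no λ ()
  inn _ _ ≟V S = no λ ()
  inn _ _ ≟V T = no λ ()

  first-adj : ∀ i → Adj G T (first i)
  first-adj i = edge i 0 (ℓ≥1 i)

  last-adj : ∀ i → Adj G S (last i)
  last-adj i = subst (λ v → Adj G v (last i)) (at-S i ≤-refl) (edge⁻ i (pred (ℓ i)) (≤pred⇒<ℓ ≤-refl))

  interior : VSet G → Fin k → ℕ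
  interior U i = count U (map (inn i) (allFin (pred (ℓ i))))

  ends : VSet G → ℕ
  ends U = ⟦ U T ⟧ + ⟦ U S ⟧

  card-split : ∀ U → card G U ≡ ends U + sum (interior U)
  card-split U = begin
    card G U                                   ≡⟨ count-∷ U S (T ∷ inner) ⟩
    ⟦ U S ⟧ + count U (T ∷ inner)              ≡⟨ cong (⟦ U S ⟧ +_) (count-∷ U T inner) ⟩
    ⟦ U S ⟧ + (⟦ U T ⟧ + count U inner)        ≡⟨ cong (λ n → ⟦ U S ⟧ + (⟦ U T ⟧ + n)) (count-concatMap-tabulate U k id _) ⟩
    ⟦ U S ⟧ + (⟦ U T ⟧ + sum (interior U))     ≡⟨ +-assoc ⟦ U S ⟧ _ _ ⟨
    ⟦ U S ⟧ + ⟦ U T ⟧ + sum (interior U)       ≡⟨ cong (_+ sum (interior U)) (+-comm ⟦ U S ⟧ ⟦ U T ⟧) ⟩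
    ends U + sum (interior U)                  ∎
    where
    open ≡-Reasoning
    inner = concatMap (λ i → map (inn i) (allFin (pred (ℓ i)))) (allFin k)

  interior≡tally : ∀ U i → interior U i ≡ tally (λ p → U (at′ i (suc p))) (pred (ℓ i))
  interior≡tally U i = trans (cong (count U) (map-tabulate id (inn i)))
    (count-tabulate U (pred (ℓ i)) (inn i) _ (λ j → cong U (sym (at-inn i j))))

  path-bound : ∀ U → IsVertexCover G U → ∀ i → ℓ i ≤ ends U + (interior U i + interior U i)
  path-bound U cover i = subst₂ _≤_ (suc-pred-ℓ i)
    (cong₂ (λ v a → ⟦ U T ⟧ + ⟦ U v ⟧ + (a + a)) (at-S i ≤-refl) (sym (interior≡tally U i)))
    (path-cover-bound (pred (ℓ i)) (U ∘ at′ i) (λ p p≤ → cover _ _ (edge i p (≤pred⇒<ℓ p≤))))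

  -- Dropping T from a cover containing the first vertex of path i still covers that path.
  path-bound-first : ∀ U → IsVertexCover G U → ∀ i → U (first i) ≡ true →
    ℓ i ≤ ⟦ U S ⟧ + (interior U i + interior U i)
  path-bound-first U cover i first∈U = subst₂ _≤_ (suc-pred-ℓ i)
    (cong₂ (λ v a → ⟦ U v ⟧ + (a + a)) (at-S i ≤-refl) (sym (interior≡tally U i)))
    (path-cover-bound (pred (ℓ i)) f f-cover)
    where
    f : ℕ → Bool
    f zero    = false
    f (suc p) = U (at′ i (suc p))
    f-cover : ∀ p → p ≤ pred (ℓ i) → f p ≡ true ⊎ f (suc p) ≡ true
    f-cover zero    _  = inj₂ first∈U
    f-cover (suc p) p≤ = cover _ _ (edge i (suc p) (≤pred⇒<ℓ p≤))

  -- β i selects the even (true) or odd (false) positions of path i; both ends are always in.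
  alternating : (Fin k → Bool) → VSet G
  alternating β S         = true
  alternating β T         = true
  alternating β (inn i j) = alt (β i) (suc (toℕ j))

  alternating-at : ∀ β i p → alt (β i) p ≡ true → alternating β (at′ i p) ≡ true
  alternating-at β i zero    _ = refl
  alternating-at β i (suc p) h with at-suc-view i p
  ... | inj₁ (j , refl , eq) = subst (λ v → alternating β v ≡ true) (sym eq) h
  ... | inj₂ (_ , eq)        = subst (λ v → alternating β v ≡ true) (sym eq) refl

  alternating-at⇔ : ∀ β i p → p ≤ ℓ i →
    (alternating β (at′ i p) ≡ true) ⇔ (alt (β i) p ≡ true ⊎ p ≡ 0 ⊎ p ≡ ℓ i)
  alternating-at⇔ β i zero _ = mk⇔ (λ _ → inj₂ (inj₁ refl)) (λ _ → refl)
  alternating-at⇔ β i (suc p) p≤ℓ with at-suc-view i p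
  ... | inj₁ (j , refl , eq) rewrite eq = mk⇔ inj₁ from
    where
    from : alt (β i) (suc (toℕ j)) ≡ true ⊎ suc (toℕ j) ≡ 0 ⊎ suc (toℕ j) ≡ ℓ i → _
    from (inj₁ h)         = h
    from (inj₂ (inj₂ eq)) = ⊥-elim (<⇒≢ (inn<ℓ i j) eq)
  ... | inj₂ (ℓ≤p , eq) rewrite eq =
    mk⇔ (λ _ → inj₂ (inj₂ (≤-antisym p≤ℓ (subst (_≤ suc p) (suc-pred-ℓ i) (s≤s ℓ≤p))))) (λ _ → refl)

  alternating-cover : ∀ β → IsVertexCover G (alternating β)
  alternating-cover β v w (i , p , _ , orientation) with alt (β i) p in h | orientation
  ... | true  | inj₁ (refl , refl) = inj₁ (alternating-at β i p h)
  ... | true  | inj₂ (refl , refl) = inj₂ (alternating-at β i p h)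
  ... | false | inj₁ (refl , refl) = inj₂ (alternating-at β i (suc p) (trans (alt-suc (β i) p) (cong not h)))
  ... | false | inj₂ (refl , refl) = inj₁ (alternating-at β i (suc p) (trans (alt-suc (β i) p) (cong not h)))

  interior-alternating : ∀ β i → interior (alternating β) i ≡ tally (alt (not (β i))) (pred (ℓ i))
  interior-alternating β i = trans (cong (count (alternating β)) (map-tabulate id (inn i)))
    (count-tabulate (alternating β) (pred (ℓ i)) (inn i) _ (λ j → refl))

  module _ {β : Fin k → Bool} {i : Fin k} where

    alternating-internal : β i ≡ true → Even (ℓ i) → Internal k ℓ i (alternating β)
    alternating-internal βi even-ℓ p p≤ℓ = ⇔-trans (alternating-at⇔ β i p p≤ℓ) (mk⇔ to from)
      where
      to : alt (β i) p ≡ true ⊎ p ≡ 0 ⊎ p ≡ ℓ i → Even p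
      to (inj₁ h)            = Equivalence.to (alt-true⇔even p) (subst (λ b → alt b p ≡ true) βi h)
      to (inj₂ (inj₁ refl))  = 0 , refl
      to (inj₂ (inj₂ refl))  = even-ℓ
      from : Even p → alt (β i) p ≡ true ⊎ p ≡ 0 ⊎ p ≡ ℓ i
      from even-p = inj₁ (trans (alt-even (β i) even-p) βi)

    alternating-external : β i ≡ false → External k ℓ i (alternating β)
    alternating-external βi p p≤ℓ = ⇔-trans (alternating-at⇔ β i p p≤ℓ)
      (mk⇔ (Sum.map₁ λ h → Equivalence.to (alt-false⇔odd p) (subst (λ b → alt b p ≡ true) βi h))
           (Sum.map₁ λ odd-p → trans (alt-odd (β i) odd-p) (cong not βi)))

    alternating-s-path : β i ≡ false → Odd (ℓ i) → SPath k ℓ i (alternating β)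
    alternating-s-path βi odd-ℓ p p≤ℓ p≢0 = ⇔-trans (alternating-at⇔ β i p p≤ℓ) (mk⇔ to from)
      where
      to : alt (β i) p ≡ true ⊎ p ≡ 0 ⊎ p ≡ ℓ i → Odd p
      to (inj₁ h)           = Equivalence.to (alt-false⇔odd p) (subst (λ b → alt b p ≡ true) βi h)
      to (inj₂ (inj₁ p≡0))  = ⊥-elim (p≢0 p≡0)
      to (inj₂ (inj₂ refl)) = odd-ℓ
      from : Odd p → alt (β i) p ≡ true ⊎ p ≡ 0 ⊎ p ≡ ℓ i
      from odd-p = inj₁ (trans (alt-odd (β i) odd-p) (cong not βi))

    alternating-t-path : β i ≡ true → TPath k ℓ i (alternating β)
    alternating-t-path βi p p≤ℓ p≢ℓ = ⇔-trans (alternating-at⇔ β i p p≤ℓ) (mk⇔ to from)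
      where
      to : alt (β i) p ≡ true ⊎ p ≡ 0 ⊎ p ≡ ℓ i → Even p
      to (inj₁ h)           = Equivalence.to (alt-true⇔even p) (subst (λ b → alt b p ≡ true) βi h)
      to (inj₂ (inj₁ refl)) = 0 , refl
      to (inj₂ (inj₂ p≡ℓ))  = ⊥-elim (p≢ℓ p≡ℓ)
      from : Even p → alt (β i) p ≡ true ⊎ p ≡ 0 ⊎ p ≡ ℓ i
      from even-p = inj₁ (trans (alt-even (β i) even-p) βi)

  -- Each of the four path properties determines which interior vertices of the path lie in U.
  record Pinned (U : VSet G) (i : Fin k) (Q : ℕ → Set) : Set where
    constructor pinned
    field membership : ∀ j → (U (inn i j) ≡ true) ⇔ Q (suc (toℕ j))

  pinned-unique : ∀ {U U′ i Q} → Pinned U i Q → Pinned U′ i Q → ∀ j → U (inn i j) ≡ U′ (inn i j)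
  pinned-unique (pinned U∈) (pinned U′∈) j = ⇔-true-≡ (U∈ j) (U′∈ j)

  module _ {U : VSet G} {i : Fin k} where

    private
      along : ∀ Q → (∀ j → (U (at′ i (suc (toℕ j))) ≡ true) ⇔ Q (suc (toℕ j))) → Pinned U i Q
      along Q h = pinned λ j → subst (λ v → (U v ≡ true) ⇔ _) (at-inn i j) (h j)

      inside : ∀ j → suc (toℕ j) ≤ ℓ i
      inside j = <⇒≤ (inn<ℓ i j)

    internal-pinned : Internal k ℓ i U → Pinned U i Even
    internal-pinned int = along Even λ j → int _ (inside j)

    external-pinned : External k ℓ i U → Pinned U i Odd
    external-pinned ext = along Odd λ j → ⇔-trans (ext _ (inside j)) (mk⇔ (to j) inj₁)
      where
      to : ∀ j → Odd (suc (toℕ j)) ⊎ suc (toℕ j) ≡ 0 ⊎ suc (toℕ j) ≡ ℓ i → Odd (suc (toℕ j))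
      to j (inj₁ odd)         = odd
      to j (inj₂ (inj₂ j+1≡ℓ)) = ⊥-elim (<⇒≢ (inn<ℓ i j) j+1≡ℓ)

    s-path-pinned : SPath k ℓ i U → Pinned U i Odd
    s-path-pinned sp = along Odd λ j → sp _ (inside j) λ ()

    t-path-pinned : TPath k ℓ i U → Pinned U i Even
    t-path-pinned tp = along Even λ j → tp _ (inside j) (<⇒≢ (inn<ℓ i j))

  data Dir : Set where
    stay up down : Dir

  reverse : Dir → Dir
  reverse stay = stay
  reverse up   = down
  reverse down = up

  reverse-involutive : ∀ δ → reverse (reverse δ) ≡ δ
  reverse-involutive stay = refl
  reverse-involutive up   = refl
  reverse-involutive down = refl

  flip : Dir → Bool → Bool
  flip stay b = b
  flip up   b = not b
  flip down b = not b

  shift : Dir → (i : Fin k) → Fin (pred (ℓ i)) → Vertex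
  shift stay i j = inn i j
  shift up   i j = at′ i (suc (suc (toℕ j)))
  shift down i j = at′ i (toℕ j)

  steer : List (Fin k × Dir) → Fin k → Dir
  steer []             = λ _ → stay
  steer ((p , δ) ∷ ps) = steer ps [ p ]≔ δ

  steer-here : ∀ p δ ps → steer ((p , δ) ∷ ps) p ≡ δ
  steer-here p δ ps = []≔-updates (steer ps) p

  steer-there : ∀ {p δ} ps {j} → j ≢ p → steer ((p , δ) ∷ ps) j ≡ steer ps j
  steer-there ps j≢p = []≔-minimal (steer ps) j≢p

  steer-next : ∀ {p q δ δ′} ps → p ≢ q → steer ((q , δ′) ∷ (p , δ) ∷ ps) p ≡ δ
  steer-next {p} {δ = δ} ps p≢q = trans (steer-there ((p , δ) ∷ ps) p≢q) (steer-here p δ ps)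

  steer-unlisted : ∀ ps {j} → All (λ pδ → j ≢ proj₁ pδ) ps → steer ps j ≡ stay
  steer-unlisted []             []           = refl
  steer-unlisted ((p , δ) ∷ ps) (j≢p ∷ j∉ps) = trans (steer-there ps j≢p) (steer-unlisted ps j∉ps)

  steer-moving : ∀ ps {j δ} → steer ps j ≡ δ → δ ≢ stay → (j , δ) ∈ ps
  steer-moving []             refl δ≢stay = ⊥-elim (δ≢stay refl)
  steer-moving ((p , δ′) ∷ ps) {j} eq δ≢stay with []≔-inv (steer ps) p j eq
  ... | inj₁ (refl , refl) = here refl
  ... | inj₂ eq′           = there (steer-moving ps eq′ δ≢stay)

  move : (Fin k → Dir) → Vertex → Vertex → Vertex → Vertex
  move d t′ s′ S         = s′
  move d t′ s′ T         = t′
  move d t′ s′ (inn i j) = shift (d i) i j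

  private variable
    d d′ : Fin k → Dir
    t′ s′ t″ s″ : Vertex
    β β′ : Fin k → Bool

  move-up : ∀ {i p} → d i ≡ up → suc p < ℓ i → move d t′ s′ (at′ i (suc p)) ≡ at′ i (suc (suc p))
  move-up {i = i} {p = p} up! p+1<ℓ with at-suc-view i p
  ... | inj₁ (j , refl , eq) rewrite eq | up! = refl
  ... | inj₂ (ℓ≤p , _)       = ⊥-elim (<⇒≱ (<ℓ⇒≤pred p+1<ℓ) ℓ≤p)

  move-down : ∀ {i p} → d i ≡ down → suc p < ℓ i → move d t′ s′ (at′ i (suc p)) ≡ at′ i p
  move-down {i = i} {p = p} down! p+1<ℓ with at-suc-view i p
  ... | inj₁ (j , refl , eq) rewrite eq | down! = refl
  ... | inj₂ (ℓ≤p , _)       = ⊥-elim (<⇒≱ (<ℓ⇒≤pred p+1<ℓ) ℓ≤p)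

  move-first : ∀ {i} → d i ≡ down → 2 ≤ ℓ i → move d t′ s′ (first i) ≡ T
  move-first down! 2≤ℓ = move-down down! 2≤ℓ

  move-last : ∀ {i} → d i ≡ up → 2 ≤ ℓ i → move d t′ s′ (last i) ≡ S
  move-last {d = d} {t′ = t′} {s′ = s′} {i = i} up! 2≤ℓ = begin
    move d t′ s′ (at′ i (pred (ℓ i)))  ≡⟨ cong (move d t′ s′ ∘ at′ i) q+1≡ ⟨
    move d t′ s′ (at′ i (suc q))       ≡⟨ move-up up! (≤pred⇒<ℓ (≤-reflexive q+1≡)) ⟩
    at′ i (suc (suc q))                ≡⟨ at-S i (≤-reflexive (sym q+1≡)) ⟩
    S                                  ∎
    where
    open ≡-Reasoning
    q = pred (pred (ℓ i))
    q+1≡ : suc q ≡ pred (ℓ i)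
    q+1≡ = suc-pred (pred (ℓ i)) ⦃ >-nonZero (pred-mono-≤ 2≤ℓ) ⦄

  move-up-at : ∀ {i p} → d i ≡ up → p < ℓ i → (p ≡ 0 → t′ ≡ first i) →
    move d t′ s′ (at′ i p) ≡ at′ i (suc p)
  move-up-at {p = zero}  _   _   t′≡first = t′≡first refl
  move-up-at {p = suc q} up! p<ℓ _        = move-up up! p<ℓ

  move-down-at : ∀ {i p} → d i ≡ down → p < ℓ i → (suc p ≡ ℓ i → s′ ≡ last i) →
    move d t′ s′ (at′ i (suc p)) ≡ at′ i p
  move-down-at {d = d} {s′ = s′} {t′ = t′} {i = i} {p = p} down! p<ℓ s′≡last with m≤n⇒m<n∨m≡n p<ℓ
  ... | inj₁ p+1<ℓ = move-down down! p+1<ℓ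
  ... | inj₂ p+1≡ℓ = begin
    move d t′ s′ (at′ i (suc p))  ≡⟨ cong (move d t′ s′) (at-S i (≤-reflexive ℓ-1≡p)) ⟩
    s′                            ≡⟨ s′≡last p+1≡ℓ ⟩
    at′ i (pred (ℓ i))            ≡⟨ cong (at′ i) ℓ-1≡p ⟩
    at′ i p                       ∎
    where
    open ≡-Reasoning
    ℓ-1≡p : pred (ℓ i) ≡ p
    ℓ-1≡p = cong pred (sym p+1≡ℓ)

  move-reach : InClosedNbhd G T t′ → InClosedNbhd G S s′ → ∀ u → InClosedNbhd G u (move d t′ s′ u)
  move-reach t′~T s′~S S = s′~S
  move-reach t′~T s′~S T = t′~T
  move-reach {d = d} t′~T s′~S (inn i j) with d i
  ... | stay = inj₁ refl
  ... | up   = inj₂ (subst (λ v → Adj G v (at′ i (suc (suc (toℕ j))))) (at-inn i j) (edge i _ (inn<ℓ i j)))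
  ... | down = inj₂ (subst (λ v → Adj G v (at′ i (toℕ j))) (at-inn i j) (edge⁻ i _ (<-trans (n<1+n _) (inn<ℓ i j))))

  move-into : (∀ i → β′ i ≡ flip (d i) (β i)) →
    alternating β′ t′ ≡ true → alternating β′ s′ ≡ true →
    ∀ u → alternating β u ≡ true → alternating β′ (move d t′ s′ u) ≡ true
  move-into flips t′∈ s′∈ S _ = s′∈
  move-into flips t′∈ s′∈ T _ = t′∈
  move-into {β′ = β′} {d = d} {β = β} flips t′∈ s′∈ (inn i j) u∈ with d i | flips i
  ... | stay | β′≡β = subst (λ b → alt b (suc (toℕ j)) ≡ true) (sym β′≡β) u∈
  ... | up   | β′≡¬β = alternating-at β′ i (suc (suc (toℕ j)))
    (subst (λ b → alt b (suc (toℕ j)) ≡ true) (sym (trans (cong not β′≡¬β) (not-involutive (β i)))) u∈)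
  ... | down | β′≡¬β = alternating-at β′ i (toℕ j) (subst (λ b → alt b (toℕ j) ≡ true) (sym β′≡¬β) u∈)

  move-back : (∀ i → d′ i ≡ reverse (d i)) →
    move d′ t″ s″ t′ ≡ T → move d′ t″ s″ s′ ≡ S →
    (∀ i → d i ≡ up → alt (β i) (pred (ℓ i)) ≡ true → s″ ≡ last i) →
    (∀ i → d i ≡ down → β i ≡ false → t″ ≡ first i) →
    ∀ u → alternating β u ≡ true → move d′ t″ s″ (move d t′ s′ u) ≡ u
  move-back reverses T-back S-back last-up first-down S _ = S-back
  move-back reverses T-back S-back last-up first-down T _ = T-back
  move-back {d′ = d′} {d = d} {t″ = t″} {s″ = s″} {β = β} reverses _ _ last-up first-down (inn i j) u∈
    with d i in di | reverses i
  ... | stay | d′i = cong (λ x → shift x i j) d′i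
  ... | up   | d′i with m≤n⇒m<n∨m≡n (inn<ℓ i j)
  ...   | inj₁ j+2<ℓ = trans (move-down d′i j+2<ℓ) (at-inn i j)
  ...   | inj₂ j+2≡ℓ = begin
    move d′ t″ s″ (at′ i (suc (suc (toℕ j))))  ≡⟨ cong (move d′ t″ s″ ∘ at′ i) j+2≡ℓ ⟩
    move d′ t″ s″ (at′ i (ℓ i))                ≡⟨ cong (move d′ t″ s″) (at-ℓ i) ⟩
    s″                                         ≡⟨ last-up i di (subst (λ p → alt (β i) p ≡ true) j+1≡ u∈) ⟩
    at′ i (pred (ℓ i))                         ≡⟨ cong (at′ i) j+1≡ ⟨
    at′ i (suc (toℕ j))                        ≡⟨ at-inn i j ⟩
    inn i j                                    ∎
    where
    open ≡-Reasoning
    j+1≡ : suc (toℕ j) ≡ pred (ℓ i)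
    j+1≡ = cong pred j+2≡ℓ
  move-back {d′ = d′} {d = d} {t″ = t″} {s″ = s″} {β = β} reverses _ _ last-up first-down (inn i j) u∈
      | down | d′i with toℕ j in j≡
  ...   | zero  = trans (first-down i di (not-injective u∈)) (subst (λ p → at′ i (suc p) ≡ inn i j) j≡ (at-inn i j))
  ...   | suc q = trans (move-up d′i (subst (_< ℓ i) j≡ (<-trans (n<1+n _) (inn<ℓ i j))))
                        (subst (λ p → at′ i (suc p) ≡ inn i j) j≡ (at-inn i j))

  record Move (β β′ : Fin k → Bool) : Set where
    field
      dir          : Fin k → Dir
      newT newS    : Vertex
      flips        : ∀ i → β′ i ≡ flip (dir i) (β i)
      newT∈        : alternating β′ newT ≡ true
      newS∈        : alternating β′ newS ≡ true
      newT-reach   : InClosedNbhd G T newT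
      newS-reach   : InClosedNbhd G S newS

    apply : Vertex → Vertex
    apply = move dir newT newS
  open Move

  record Undoes (φ : Move β β′) (ψ : Move β′ β) : Set where
    field
      reverses   : ∀ i → dir ψ i ≡ reverse (dir φ i)
      newT-back  : apply ψ (newT φ) ≡ T
      newS-back  : apply ψ (newS φ) ≡ S
      last-up    : ∀ i → dir φ i ≡ up → alt (β i) (pred (ℓ i)) ≡ true → newS ψ ≡ last i
      first-down : ∀ i → dir φ i ≡ down → β i ≡ false → newT ψ ≡ first i

  undo : {φ : Move β β′} {ψ : Move β′ β} → Undoes φ ψ →
    ∀ u → alternating β u ≡ true → apply ψ (apply φ u) ≡ u
  undo ψ∘φ = move-back reverses newT-back newS-back last-up first-down
    where open Undoes ψ∘φ

  record Reversible (β β′ : Fin k → Bool) : Set where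
    field
      forth        : Move β β′
      back         : Move β′ β
      forth-undone : Undoes forth back
      back-undone  : Undoes back forth

  reversed : Reversible β β′ → Reversible β′ β
  reversed m = record { forth = back ; back = forth ; forth-undone = back-undone ; back-undone = forth-undone }
    where open Reversible m

  reversible-legal : (m : Reversible β β′) →
    Legal G (alternating β) (apply (Reversible.forth m)) (alternating β′)
  reversible-legal m = legal-by-inverse G (apply forth) (apply back)
    (λ u _ → move-reach (newT-reach forth) (newS-reach forth) u)
    (move-into (flips forth) (newT∈ forth) (newS∈ forth)) (move-into (flips back) (newT∈ back) (newS∈ back))
    (undo forth-undone) (undo back-undone)
    where open Reversible m

module OneOddPath (k : ℕ) (k≥3 : 3 ≤ k) (ℓ : Fin k → ℕ) (o : Fin k) (ℓ≥1 : ∀ i → 1 ≤ ℓ i)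
  (odd-o : Odd (ℓ o)) (even : ∀ i → i ≢ o → Even (ℓ i)) where

  open Melon k ℓ ℓ≥1

  odd-pred : ∀ {i} → i ≢ o → Odd (pred (ℓ i))
  odd-pred {i} i≢o with even i i≢o | ℓ≥1 i
  ... | suc m , ℓ≡ | _   = m , trans (cong pred ℓ≡) (+-suc m m)
  ... | zero  , ℓ≡ | ℓ≥1′ = ⊥-elim (<⇒≱ ℓ≥1′ (≤-reflexive ℓ≡))

  ℓ≥2 : ∀ {i} → i ≢ o → 2 ≤ ℓ i
  ℓ≥2 {i} i≢o with m , ℓ-1≡ ← odd-pred i≢o =
    subst (2 ≤_) (suc-pred-ℓ i) (s≤s (subst (1 ≤_) (sym ℓ-1≡) (s≤s z≤n)))

  even-pred-o : Even (pred (ℓ o))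
  even-pred-o = proj₁ odd-o , cong pred (proj₂ odd-o)

  min-interior : Fin k → ℕ
  min-interior i = ⌊ pred (ℓ i) /2⌋

  vc : ℕ
  vc = 2 + sum min-interior

  ⌈ℓ/2⌉≡1+min : ∀ i → ⌈ ℓ i /2⌉ ≡ suc (min-interior i)
  ⌈ℓ/2⌉≡1+min i with ℓ i | ℓ≥1 i
  ... | suc _ | _ = refl

  ⌊ℓ/2⌋≡1+min : ∀ {i} → i ≢ o → ⌊ ℓ i /2⌋ ≡ suc (min-interior i)
  ⌊ℓ/2⌋≡1+min {i} i≢o = trans (sym (⌈n/2⌉≡⌊n/2⌋ (even i i≢o))) (⌈ℓ/2⌉≡1+min i)

  interior-even-positions : ∀ {β i} → β i ≡ true → interior (alternating β) i ≡ min-interior i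
  interior-even-positions {β} {i} βi = begin
    interior (alternating β) i          ≡⟨ interior-alternating β i ⟩
    tally (alt (not (β i))) (pred (ℓ i)) ≡⟨ cong (λ b → tally (alt (not b)) (pred (ℓ i))) βi ⟩
    tally (alt false) (pred (ℓ i))       ≡⟨ tally-alt-false (pred (ℓ i)) ⟩
    min-interior i                       ∎
    where open ≡-Reasoning

  interior-odd-positions : ∀ {β i} → β i ≡ false →
    interior (alternating β) i ≡ ⌈ pred (ℓ i) /2⌉
  interior-odd-positions {β} {i} βi = begin
    interior (alternating β) i          ≡⟨ interior-alternating β i ⟩
    tally (alt (not (β i))) (pred (ℓ i)) ≡⟨ cong (λ b → tally (alt (not b)) (pred (ℓ i))) βi ⟩
    tally (alt true) (pred (ℓ i))        ≡⟨ tally-alt-true (pred (ℓ i)) ⟩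
    ⌈ pred (ℓ i) /2⌉                     ∎
    where open ≡-Reasoning

  ends-view : ∀ U → (U T ≡ true × U S ≡ true) ⊎ ends U ≤ 1
  ends-view U with U T | U S
  ... | true  | true  = inj₁ (refl , refl)
  ... | true  | false = inj₂ ≤-refl
  ... | false | true  = inj₂ ≤-refl
  ... | false | false = inj₂ z≤n

  halves-of-≤1 : ∀ {c} → c ≤ 1 → ⌊ c /2⌋ ≡ 0 × ⌈ c /2⌉ ≡ c
  halves-of-≤1 z≤n       = refl , refl
  halves-of-≤1 (s≤s z≤n) = refl , refl

  card-lower-end-missing : ∀ U → IsVertexCover G U → ends U ≤ 1 → suc vc ≤ card G U
  card-lower-end-missing U cover ends≤1 = begin
    3 + sum min-interior          ≤⟨ +-monoˡ-≤ (sum min-interior) k≥3 ⟩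
    k + sum min-interior          ≡⟨ sum-suc min-interior ⟨
    sum (suc ∘ min-interior)      ≡⟨ +-identityʳ _ ⟨
    sum (suc ∘ min-interior) + 0  ≤⟨ sum-≤-at o even-path odd-path ⟩
    sum a + ends U                ≡⟨ +-comm (sum a) (ends U) ⟩
    ends U + sum a                ≡⟨ card-split U ⟨
    card G U                      ∎
    where
    open ≤-Reasoning
    a = interior U
    even-path : ∀ i → i ≢ o → suc (min-interior i) ≤ a i
    even-path i i≢o = subst₂ _≤_ (⌊ℓ/2⌋≡1+min i≢o) (cong (_+ a i) (proj₁ (halves-of-≤1 ends≤1)))
      (⌊n/2⌋-bound (ends U) (a i) (path-bound U cover i))
    odd-path : suc (min-interior o) + 0 ≤ a o + ends U
    odd-path = subst₂ _≤_ (trans (⌈ℓ/2⌉≡1+min o) (sym (+-identityʳ _)))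
      (trans (cong (_+ a o) (proj₂ (halves-of-≤1 ends≤1))) (+-comm (ends U) (a o)))
      (⌈n/2⌉-bound (ends U) (a o) (path-bound U cover o))

  module _ (U : VSet G) (cover : IsVertexCover G U) (T∈U : U T ≡ true) (S∈U : U S ≡ true) where

    private
      a = interior U

      card≡ : card G U ≡ 2 + sum a
      card≡ = trans (card-split U) (cong₂ (λ t s → ⟦ t ⟧ + ⟦ s ⟧ + sum a) T∈U S∈U)

      min≤a : ∀ i → min-interior i ≤ a i
      min≤a i = s≤s⁻¹ (subst₂ _≤_ (⌈ℓ/2⌉≡1+min i) (cong₂ (λ t s → ⌈ ⟦ t ⟧ + ⟦ s ⟧ /2⌉ + a i) T∈U S∈U)
        (⌈n/2⌉-bound (ends U) (a i) (path-bound U cover i)))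

    card-lower-ends-covered : vc ≤ card G U
    card-lower-ends-covered = subst (vc ≤_) (sym card≡) (+-monoʳ-≤ 2 (sum-mono min≤a))

    card-lower-first-covered : ∀ {i} → i ≢ o → U (first i) ≡ true → suc vc ≤ card G U
    card-lower-first-covered {i} i≢o first∈U = subst (suc vc ≤_) (sym card≡) (+-monoʳ-≤ 2 (begin
      suc (sum min-interior)        ≡⟨ +-comm 1 _ ⟩
      sum min-interior + 1          ≤⟨ sum-≤-at i (λ j _ → min≤a j) at-i ⟩
      sum a + 0                     ≡⟨ +-identityʳ _ ⟩
      sum a                         ∎))
      where
      open ≤-Reasoning
      at-i : min-interior i + 1 ≤ a i + 0
      at-i = subst₂ _≤_ (trans (⌊ℓ/2⌋≡1+min i≢o) (+-comm 1 _))
        (trans (cong (_+ a i) (⌊⟦b⟧/2⌋≡0 (U S))) (sym (+-identityʳ _)))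
        (⌊n/2⌋-bound ⟦ U S ⟧ (a i) (path-bound-first U cover i first∈U))

  vc-lower : ∀ U → IsVertexCover G U → vc ≤ card G U
  vc-lower U cover with ends-view U
  ... | inj₁ (T∈U , S∈U) = card-lower-ends-covered U cover T∈U S∈U
  ... | inj₂ ends≤1      = <⇒≤ (card-lower-end-missing U cover ends≤1)

  vc-lower-first : ∀ U → IsVertexCover G U → ∀ {i} → i ≢ o → U (first i) ≡ true → suc vc ≤ card G U
  vc-lower-first U cover i≢o first∈U with ends-view U
  ... | inj₁ (T∈U , S∈U) = card-lower-first-covered U cover T∈U S∈U i≢o first∈U
  ... | inj₂ ends≤1      = card-lower-end-missing U cover ends≤1

  endBit : End k ℓ → Bool
  endBit s = false
  endBit t = true

  β⟨_,_⟩ : End k ℓ → Fin k → Fin k → Bool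
  β⟨ x , e ⟩ = ((λ _ → true) [ o ]≔ endBit x) [ e ]≔ false

  U⟨_,_⟩ : End k ℓ → Fin k → VSet G
  U⟨ x , e ⟩ = alternating β⟨ x , e ⟩

  module _ {x : End k ℓ} {e : Fin k} where

    β-external : β⟨ x , e ⟩ e ≡ false
    β-external = []≔-updates _ e

    β-odd : e ≢ o → β⟨ x , e ⟩ o ≡ endBit x
    β-odd e≢o = trans ([]≔-minimal _ (e≢o ∘ sym)) ([]≔-updates _ o)

    β-internal : ∀ {i} → i ≢ o → i ≢ e → β⟨ x , e ⟩ i ≡ true
    β-internal i≢o i≢e = trans ([]≔-minimal _ i≢e) ([]≔-minimal _ i≢o)

  x-path-of-U⟨⟩ : ∀ x {e} → e ≢ o → XPath k ℓ x o U⟨ x , e ⟩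
  x-path-of-U⟨⟩ s e≢o = alternating-s-path (β-odd e≢o) odd-o
  x-path-of-U⟨⟩ t e≢o = alternating-t-path (β-odd e≢o)

  U⟨⟩-is-UxPe : ∀ x {e} → e ≢ o → IsUxPe k ℓ o x e U⟨ x , e ⟩
  U⟨⟩-is-UxPe x e≢o = alternating-external β-external ,
    (λ i i≢o i≢e → alternating-internal (β-internal i≢o i≢e) (even i i≢o)) ,
    x-path-of-U⟨⟩ x e≢o

  U⟨⟩∈𝒰 : ∀ x {e} → e ≢ o → 𝒰fam k ℓ o U⟨ x , e ⟩
  U⟨⟩∈𝒰 x {e} e≢o = x , e , e≢o , U⟨⟩-is-UxPe x e≢o

  end-parity : End k ℓ → ℕ → Set
  end-parity s = Odd
  end-parity t = Even

  x-path-pinned : ∀ x {U} → XPath k ℓ x o U → Pinned U o (end-parity x)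
  x-path-pinned s = s-path-pinned
  x-path-pinned t = t-path-pinned

  𝒰⇒U⟨⟩ : ∀ U → 𝒰fam k ℓ o U → Σ (End k ℓ) λ x → Σ (Fin k) λ e → e ≢ o × (∀ v → U v ≡ U⟨ x , e ⟩ v)
  𝒰⇒U⟨⟩ U (x , e , e≢o , ext , int , xp) = x , e , e≢o , agree
    where
    ext′ = proj₁ (U⟨⟩-is-UxPe x e≢o)
    int′ = proj₁ (proj₂ (U⟨⟩-is-UxPe x e≢o))
    agree : ∀ v → U v ≡ U⟨ x , e ⟩ v
    agree S = subst (λ v → U v ≡ true) (at-ℓ e) (Equivalence.from (ext (ℓ e) ≤-refl) (inj₂ (inj₂ refl)))
    agree T = Equivalence.from (ext 0 z≤n) (inj₂ (inj₁ refl))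
    agree (inn i j) with i ≟ e | i ≟ o
    ... | yes refl | _        =
      pinned-unique (external-pinned {U = U} ext) (external-pinned {U = U⟨ x , e ⟩} ext′) j
    ... | no _     | yes refl = pinned-unique (x-path-pinned x xp) (x-path-pinned x (x-path-of-U⟨⟩ x e≢o)) j
    ... | no i≢e   | no i≢o   = pinned-unique (internal-pinned {U = U} (int i i≢o i≢e))
                                              (internal-pinned {U = U⟨ x , e ⟩} (int′ i i≢o i≢e)) j

  card-even-positions : card G (alternating (λ _ → true)) ≡ vc
  card-even-positions = trans (card-split (alternating (λ _ → true)))
    (cong (2 +_) (sum-cong-≗ {x = interior (alternating (λ _ → true))} (λ i → interior-even-positions {i = i} refl)))

  card-U⟨⟩ : ∀ x {e} → e ≢ o → card G U⟨ x , e ⟩ ≡ suc vc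
  card-U⟨⟩ x {e} e≢o = begin
    card G U⟨ x , e ⟩                   ≡⟨ card-split U⟨ x , e ⟩ ⟩
    2 + sum (interior U⟨ x , e ⟩)       ≡⟨ cong (2 +_) (+-identityʳ _) ⟨
    2 + (sum (interior U⟨ x , e ⟩) + 0) ≡⟨ cong (2 +_) (sum-≡-at e elsewhere at-e) ⟩
    2 + (sum min-interior + 1)          ≡⟨ cong (2 +_) (+-comm _ 1) ⟩
    suc vc                              ∎
    where
    open ≡-Reasoning
    at-e : interior U⟨ x , e ⟩ e + 0 ≡ min-interior e + 1
    at-e = trans (+-identityʳ _) (trans (interior-odd-positions β-external)
             (trans (⌈n/2⌉≡1+⌊n/2⌋ (odd-pred e≢o)) (+-comm 1 _)))
    on-o : ∀ x → interior U⟨ x , e ⟩ o ≡ min-interior o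
    on-o s = trans (interior-odd-positions (β-odd e≢o)) (⌈n/2⌉≡⌊n/2⌋ even-pred-o)
    on-o t = interior-even-positions (β-odd e≢o)
    elsewhere : ∀ i → i ≢ e → interior U⟨ x , e ⟩ i ≡ min-interior i
    elsewhere i i≢e with i ≟ o
    ... | yes refl = on-o x
    ... | no i≢o   = interior-even-positions (β-internal i≢o i≢e)

  β-end-irrelevant : ∀ x y {e j} → j ≢ o → β⟨ x , e ⟩ j ≡ β⟨ y , e ⟩ j
  β-end-irrelevant x y {e} {j} j≢o with j ≟ e
  ... | yes refl = trans β-external (sym β-external)
  ... | no j≢e   = trans (β-internal j≢o j≢e) (sym (β-internal j≢o j≢e))

  alt-last-even-path : ∀ {j} → j ≢ o → ∀ b → alt b (pred (ℓ j)) ≡ not b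
  alt-last-even-path j≢o b = alt-odd b (odd-pred j≢o)

  alt-last-o : ∀ b → alt b (pred (ℓ o)) ≡ b
  alt-last-o b = alt-even b even-pred-o

  β-move-external : ∀ {x e a j} → j ≢ a → j ≢ e → β⟨ x , a ⟩ j ≡ β⟨ x , e ⟩ j
  β-move-external j≢a j≢e = trans ([]≔-minimal _ j≢a) (sym ([]≔-minimal _ j≢e))

  flips-by : ∀ {b₁ b₂ b₁′ b₂′ : Bool} {δ δ′ : Dir} →
    b₂ ≡ b₂′ → δ ≡ δ′ → b₁ ≡ b₁′ → b₂′ ≡ flip δ′ b₁′ → b₂ ≡ flip δ b₁
  flips-by β′j dj βj eq = trans β′j (trans eq (sym (cong₂ flip dj βj)))

  true≢false : true ≢ false
  true≢false ()

  reverses-by : ∀ {δ₁ δ₂ δ₁′ δ₂′ : Dir} → δ₂ ≡ δ₂′ → δ₁ ≡ δ₁′ → δ₂′ ≡ reverse δ₁′ → δ₂ ≡ reverse δ₁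
  reverses-by δ₂≡ δ₁≡ eq = trans δ₂≡ (trans eq (cong reverse (sym δ₁≡)))

  o-last-unguarded : ∀ {b} → b ≡ false → alt b (pred (ℓ o)) ≢ true
  o-last-unguarded refl h = true≢false (trans (sym h) (alt-last-o false))

  even-path-last-unguarded : ∀ {b j} → j ≢ o → b ≡ true → alt b (pred (ℓ j)) ≢ true
  even-path-last-unguarded j≢o refl h = true≢false (trans (sym h) (alt-last-even-path j≢o true))

  module _ (x : End k ℓ) {e a : Fin k} (e≢o : e ≢ o) (a≢o : a ≢ o) (a≢e : a ≢ e) (e≢a : e ≢ a) where

    external-down : Move β⟨ x , e ⟩ β⟨ x , a ⟩
    external-down = record
      { dir        = steer ((a , up) ∷ (e , down) ∷ [])
      ; newT       = first a
      ; newS       = S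
      ; flips      = flips
      ; newT∈      = alternating-at _ a 1 (cong not β-external)
      ; newS∈      = refl
      ; newT-reach = inj₂ (first-adj a)
      ; newS-reach = inj₁ refl
      }
      where
      flips : ∀ j → β⟨ x , a ⟩ j ≡ flip (steer ((a , up) ∷ (e , down) ∷ []) j) (β⟨ x , e ⟩ j)
      flips j with j ≟ a | j ≟ e
      ... | yes refl | _        = flips-by β-external (steer-here a up ((e , down) ∷ [])) (β-internal a≢o a≢e) refl
      ... | no j≢a   | yes refl = flips-by (β-internal e≢o e≢a) (steer-next [] j≢a) β-external refl
      ... | no j≢a   | no j≢e   = flips-by (β-move-external j≢a j≢e) (steer-unlisted _ (j≢a ∷ j≢e ∷ [])) refl refl

    external-up : Move β⟨ x , e ⟩ β⟨ x , a ⟩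
    external-up = record
      { dir        = steer ((a , down) ∷ (e , up) ∷ [])
      ; newT       = T
      ; newS       = last a
      ; flips      = flips
      ; newT∈      = refl
      ; newS∈      = alternating-at _ a (pred (ℓ a)) (trans (alt-last-even-path a≢o _) (cong not β-external))
      ; newT-reach = inj₁ refl
      ; newS-reach = inj₂ (last-adj a)
      }
      where
      flips : ∀ j → β⟨ x , a ⟩ j ≡ flip (steer ((a , down) ∷ (e , up) ∷ []) j) (β⟨ x , e ⟩ j)
      flips j with j ≟ a | j ≟ e
      ... | yes refl | _        = flips-by β-external (steer-here a down ((e , up) ∷ [])) (β-internal a≢o a≢e) refl
      ... | no j≢a   | yes refl = flips-by (β-internal e≢o e≢a) (steer-next [] j≢a) β-external refl
      ... | no j≢a   | no j≢e   = flips-by (β-move-external j≢a j≢e) (steer-unlisted _ (j≢a ∷ j≢e ∷ [])) refl refl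

  module _ (x : End k ℓ) {e a : Fin k} (e≢o : e ≢ o) (a≢o : a ≢ o) (a≢e : a ≢ e) (e≢a : e ≢ a) where

    external-down-undone : Undoes (external-down x e≢o a≢o a≢e e≢a) (external-down x a≢o e≢o e≢a a≢e)
    external-down-undone = record
      { reverses   = reverses
      ; newT-back  = move-first (steer-next [] a≢e) (ℓ≥2 a≢o)
      ; newS-back  = refl
      ; last-up    = last-up
      ; first-down = first-down
      }
      where
      reverses : ∀ j → steer ((e , up) ∷ (a , down) ∷ []) j ≡ reverse (steer ((a , up) ∷ (e , down) ∷ []) j)
      reverses j with j ≟ a | j ≟ e
      ... | yes refl | _        = reverses-by (steer-next [] a≢e) (steer-here a up ((e , down) ∷ [])) refl
      ... | no j≢a   | yes refl = reverses-by (steer-here e up ((a , down) ∷ [])) (steer-next [] e≢a) refl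
      ... | no j≢a   | no j≢e   =
        reverses-by (steer-unlisted _ (j≢e ∷ j≢a ∷ [])) (steer-unlisted _ (j≢a ∷ j≢e ∷ [])) refl
      last-up : ∀ j → steer ((a , up) ∷ (e , down) ∷ []) j ≡ up →
        alt (β⟨ x , e ⟩ j) (pred (ℓ j)) ≡ true → S ≡ last j
      last-up j up! last∈ with steer-moving ((a , up) ∷ (e , down) ∷ []) up! (λ ())
      ... | here refl = ⊥-elim (even-path-last-unguarded a≢o (β-internal a≢o a≢e) last∈)
      ... | there (here ())
      ... | there (there ())
      first-down : ∀ j → steer ((a , up) ∷ (e , down) ∷ []) j ≡ down →
        β⟨ x , e ⟩ j ≡ false → first e ≡ first j
      first-down j down! _ with steer-moving ((a , up) ∷ (e , down) ∷ []) down! (λ ())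
      ... | here ()
      ... | there (here refl) = refl
      ... | there (there ())

    external-up-undone : Undoes (external-up x e≢o a≢o a≢e e≢a) (external-up x a≢o e≢o e≢a a≢e)
    external-up-undone = record
      { reverses   = reverses
      ; newT-back  = refl
      ; newS-back  = move-last (steer-next [] a≢e) (ℓ≥2 a≢o)
      ; last-up    = last-up
      ; first-down = first-down
      }
      where
      reverses : ∀ j → steer ((e , down) ∷ (a , up) ∷ []) j ≡ reverse (steer ((a , down) ∷ (e , up) ∷ []) j)
      reverses j with j ≟ a | j ≟ e
      ... | yes refl | _        = reverses-by (steer-next [] a≢e) (steer-here a down ((e , up) ∷ [])) refl
      ... | no j≢a   | yes refl = reverses-by (steer-here e down ((a , up) ∷ [])) (steer-next [] e≢a) refl
      ... | no j≢a   | no j≢e   =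
        reverses-by (steer-unlisted _ (j≢e ∷ j≢a ∷ [])) (steer-unlisted _ (j≢a ∷ j≢e ∷ [])) refl
      last-up : ∀ j → steer ((a , down) ∷ (e , up) ∷ []) j ≡ up →
        alt (β⟨ x , e ⟩ j) (pred (ℓ j)) ≡ true → last e ≡ last j
      last-up j up! _ with steer-moving ((a , down) ∷ (e , up) ∷ []) up! (λ ())
      ... | here ()
      ... | there (here refl) = refl
      ... | there (there ())
      first-down : ∀ j → steer ((a , down) ∷ (e , up) ∷ []) j ≡ down →
        β⟨ x , e ⟩ j ≡ false → T ≡ first j
      first-down j down! a∉ with steer-moving ((a , down) ∷ (e , up) ∷ []) down! (λ ())
      ... | here refl = ⊥-elim (true≢false (trans (sym (β-internal a≢o a≢e)) a∉))
      ... | there (here ())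
      ... | there (there ())

  module _ {e : Fin k} (e≢o : e ≢ o) where

    o-up : Move β⟨ s , e ⟩ β⟨ t , e ⟩
    o-up = record
      { dir        = steer ((o , up) ∷ [])
      ; newT       = T
      ; newS       = S
      ; flips      = flips
      ; newT∈      = refl
      ; newS∈      = refl
      ; newT-reach = inj₁ refl
      ; newS-reach = inj₁ refl
      }
      where
      flips : ∀ j → β⟨ t , e ⟩ j ≡ flip (steer ((o , up) ∷ []) j) (β⟨ s , e ⟩ j)
      flips j with j ≟ o
      ... | yes refl = flips-by (β-odd e≢o) (steer-here o up []) (β-odd e≢o) refl
      ... | no j≢o   = flips-by (β-end-irrelevant t s j≢o) (steer-there [] j≢o) refl refl

    o-down : Move β⟨ t , e ⟩ β⟨ s , e ⟩
    o-down = record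
      { dir        = steer ((o , down) ∷ [])
      ; newT       = T
      ; newS       = S
      ; flips      = flips
      ; newT∈      = refl
      ; newS∈      = refl
      ; newT-reach = inj₁ refl
      ; newS-reach = inj₁ refl
      }
      where
      flips : ∀ j → β⟨ s , e ⟩ j ≡ flip (steer ((o , down) ∷ []) j) (β⟨ t , e ⟩ j)
      flips j with j ≟ o
      ... | yes refl = flips-by (β-odd e≢o) (steer-here o down []) (β-odd e≢o) refl
      ... | no j≢o   = flips-by (β-end-irrelevant s t j≢o) (steer-there [] j≢o) refl refl

    private
      o-reverses : ∀ δ j → steer ((o , reverse δ) ∷ []) j ≡ reverse (steer ((o , δ) ∷ []) j)
      o-reverses δ j with j ≟ o
      ... | yes refl = reverses-by (steer-here o (reverse δ) []) (steer-here o δ []) refl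
      ... | no j≢o   = reverses-by (steer-there [] j≢o) (steer-there [] j≢o) refl

    o-up-undone : Undoes o-up o-down
    o-up-undone = record
      { reverses   = o-reverses up
      ; newT-back  = refl
      ; newS-back  = refl
      ; last-up    = last-up
      ; first-down = first-down
      }
      where
      last-up : ∀ j → steer ((o , up) ∷ []) j ≡ up → alt (β⟨ s , e ⟩ j) (pred (ℓ j)) ≡ true → S ≡ last j
      last-up j up! last∈ with steer-moving ((o , up) ∷ []) up! (λ ())
      ... | here refl = ⊥-elim (o-last-unguarded (β-odd e≢o) last∈)
      ... | there ()
      first-down : ∀ j → steer ((o , up) ∷ []) j ≡ down → β⟨ s , e ⟩ j ≡ false → T ≡ first j
      first-down j down! _ with steer-moving ((o , up) ∷ []) down! (λ ())
      ... | here ()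
      ... | there ()

    o-down-undone : Undoes o-down o-up
    o-down-undone = record
      { reverses   = o-reverses down
      ; newT-back  = refl
      ; newS-back  = refl
      ; last-up    = last-up
      ; first-down = first-down
      }
      where
      last-up : ∀ j → steer ((o , down) ∷ []) j ≡ up → alt (β⟨ t , e ⟩ j) (pred (ℓ j)) ≡ true → S ≡ last j
      last-up j up! _ with steer-moving ((o , down) ∷ []) up! (λ ())
      ... | here ()
      ... | there ()
      first-down : ∀ j → steer ((o , down) ∷ []) j ≡ down → β⟨ t , e ⟩ j ≡ false → T ≡ first j
      first-down j down! o∉ with steer-moving ((o , down) ∷ []) down! (λ ())
      ... | here refl = ⊥-elim (true≢false (trans (sym (β-odd e≢o)) o∉))
      ... | there ()

  module _ {e a : Fin k} (e≢o : e ≢ o) (a≢o : a ≢ o) (a≢e : a ≢ e) (ℓo≥2 : 2 ≤ ℓ o) where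

    private
      e≢a : e ≢ a
      e≢a = a≢e ∘ sym

      down-up-up up-down-down : List (Fin k × Dir)
      down-up-up   = (o , down) ∷ (e , up) ∷ (a , up) ∷ []
      up-down-down = (o , up) ∷ (a , down) ∷ (e , down) ∷ []

      down-up-up-o : steer down-up-up o ≡ down
      down-up-up-o = steer-here o down ((e , up) ∷ (a , up) ∷ [])
      down-up-up-e : steer down-up-up e ≡ up
      down-up-up-e = steer-next ((a , up) ∷ []) e≢o
      down-up-up-a : steer down-up-up a ≡ up
      down-up-up-a = trans (steer-there ((e , up) ∷ (a , up) ∷ []) a≢o) (steer-next [] a≢e)
      up-down-down-o : steer up-down-down o ≡ up
      up-down-down-o = steer-here o up ((a , down) ∷ (e , down) ∷ [])
      up-down-down-a : steer up-down-down a ≡ down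
      up-down-down-a = steer-next ((e , down) ∷ []) a≢o
      up-down-down-e : steer up-down-down e ≡ down
      up-down-down-e = trans (steer-there ((a , down) ∷ (e , down) ∷ []) e≢o) (steer-next [] e≢a)

    -- T's guard moves onto a and S's guard onto o, so that e and a exchange the external role.
    o-down-via : Move β⟨ s , e ⟩ β⟨ t , a ⟩
    o-down-via = record
      { dir        = steer down-up-up
      ; newT       = first a
      ; newS       = last o
      ; flips      = flips
      ; newT∈      = alternating-at _ a 1 (cong not β-external)
      ; newS∈      = alternating-at _ o (pred (ℓ o)) (trans (alt-last-o _) (β-odd a≢o))
      ; newT-reach = inj₂ (first-adj a)
      ; newS-reach = inj₂ (last-adj o)
      }
      where
      flips : ∀ j → β⟨ t , a ⟩ j ≡ flip (steer down-up-up j) (β⟨ s , e ⟩ j)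
      flips j with j ≟ o | j ≟ e | j ≟ a
      ... | yes refl | _        | _        = flips-by (β-odd a≢o) down-up-up-o (β-odd e≢o) refl
      ... | no _     | yes refl | _        = flips-by (β-internal e≢o e≢a) down-up-up-e β-external refl
      ... | no _     | no _     | yes refl = flips-by β-external down-up-up-a (β-internal a≢o a≢e) refl
      ... | no j≢o   | no j≢e   | no j≢a   = flips-by (β-internal j≢o j≢a)
        (steer-unlisted _ (j≢o ∷ j≢e ∷ j≢a ∷ [])) (β-internal j≢o j≢e) refl

    o-up-via : Move β⟨ t , a ⟩ β⟨ s , e ⟩
    o-up-via = record
      { dir        = steer up-down-down
      ; newT       = first o
      ; newS       = last e
      ; flips      = flips
      ; newT∈      = alternating-at _ o 1 (cong not (β-odd e≢o))
      ; newS∈      = alternating-at _ e (pred (ℓ e)) (trans (alt-last-even-path e≢o _) (cong not β-external))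
      ; newT-reach = inj₂ (first-adj o)
      ; newS-reach = inj₂ (last-adj e)
      }
      where
      flips : ∀ j → β⟨ s , e ⟩ j ≡ flip (steer up-down-down j) (β⟨ t , a ⟩ j)
      flips j with j ≟ o | j ≟ e | j ≟ a
      ... | yes refl | _        | _        = flips-by (β-odd e≢o) up-down-down-o (β-odd a≢o) refl
      ... | no _     | yes refl | _        = flips-by β-external up-down-down-e (β-internal e≢o e≢a) refl
      ... | no _     | no _     | yes refl = flips-by (β-internal a≢o a≢e) up-down-down-a β-external refl
      ... | no j≢o   | no j≢e   | no j≢a   = flips-by (β-internal j≢o j≢e)
        (steer-unlisted _ (j≢o ∷ j≢a ∷ j≢e ∷ [])) (β-internal j≢o j≢a) refl

    private
      via-reverses : ∀ j → steer up-down-down j ≡ reverse (steer down-up-up j)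
      via-reverses j with j ≟ o | j ≟ e | j ≟ a
      ... | yes refl | _        | _        = reverses-by up-down-down-o down-up-up-o refl
      ... | no _     | yes refl | _        = reverses-by up-down-down-e down-up-up-e refl
      ... | no _     | no _     | yes refl = reverses-by up-down-down-a down-up-up-a refl
      ... | no j≢o   | no j≢e   | no j≢a   = reverses-by
        (steer-unlisted _ (j≢o ∷ j≢a ∷ j≢e ∷ [])) (steer-unlisted _ (j≢o ∷ j≢e ∷ j≢a ∷ [])) refl

    o-down-via-undone : Undoes o-down-via o-up-via
    o-down-via-undone = record
      { reverses   = via-reverses
      ; newT-back  = move-first up-down-down-a (ℓ≥2 a≢o)
      ; newS-back  = move-last up-down-down-o ℓo≥2
      ; last-up    = last-up
      ; first-down = first-down
      }
      where
      last-up : ∀ j → steer down-up-up j ≡ up → alt (β⟨ s , e ⟩ j) (pred (ℓ j)) ≡ true → last e ≡ last j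
      last-up j up! last∈ with steer-moving down-up-up up! (λ ())
      ... | here ()
      ... | there (here refl)         = refl
      ... | there (there (here refl)) = ⊥-elim (even-path-last-unguarded a≢o (β-internal a≢o a≢e) last∈)
      ... | there (there (there ()))
      first-down : ∀ j → steer down-up-up j ≡ down → β⟨ s , e ⟩ j ≡ false → first o ≡ first j
      first-down j down! _ with steer-moving down-up-up down! (λ ())
      ... | here refl = refl
      ... | there (here ())
      ... | there (there (here ()))
      ... | there (there (there ()))

    o-up-via-undone : Undoes o-up-via o-down-via
    o-up-via-undone = record
      { reverses   = λ j → trans (sym (reverse-involutive _)) (cong reverse (sym (via-reverses j)))
      ; newT-back  = move-first down-up-up-o ℓo≥2
      ; newS-back  = move-last down-up-up-e (ℓ≥2 e≢o)
      ; last-up    = last-up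
      ; first-down = first-down
      }
      where
      last-up : ∀ j → steer up-down-down j ≡ up → alt (β⟨ t , a ⟩ j) (pred (ℓ j)) ≡ true → last o ≡ last j
      last-up j up! _ with steer-moving up-down-down up! (λ ())
      ... | here refl = refl
      ... | there (here ())
      ... | there (there (here ()))
      ... | there (there (there ()))
      first-down : ∀ j → steer up-down-down j ≡ down → β⟨ t , a ⟩ j ≡ false → first a ≡ first j
      first-down j down! e∉ with steer-moving up-down-down down! (λ ())
      ... | here ()
      ... | there (here refl)         = refl
      ... | there (there (here refl)) = ⊥-elim (true≢false (trans (sym (β-internal e≢o e≢a)) e∉))
      ... | there (there (there ()))

  external-down-reversible : ∀ x {e a} → e ≢ o → a ≢ o → a ≢ e → e ≢ a → Reversible β⟨ x , e ⟩ β⟨ x , a ⟩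
  external-down-reversible x e≢o a≢o a≢e e≢a = record
    { forth        = external-down x e≢o a≢o a≢e e≢a
    ; back         = external-down x a≢o e≢o e≢a a≢e
    ; forth-undone = external-down-undone x e≢o a≢o a≢e e≢a
    ; back-undone  = external-down-undone x a≢o e≢o e≢a a≢e
    }

  external-up-reversible : ∀ x {e a} → e ≢ o → a ≢ o → a ≢ e → e ≢ a → Reversible β⟨ x , e ⟩ β⟨ x , a ⟩
  external-up-reversible x e≢o a≢o a≢e e≢a = record
    { forth        = external-up x e≢o a≢o a≢e e≢a
    ; back         = external-up x a≢o e≢o e≢a a≢e
    ; forth-undone = external-up-undone x e≢o a≢o a≢e e≢a
    ; back-undone  = external-up-undone x a≢o e≢o e≢a a≢e
    }

  o-up-reversible : ∀ {e} → e ≢ o → Reversible β⟨ s , e ⟩ β⟨ t , e ⟩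
  o-up-reversible e≢o = record
    { forth        = o-up e≢o
    ; back         = o-down e≢o
    ; forth-undone = o-up-undone e≢o
    ; back-undone  = o-down-undone e≢o
    }

  o-down-via-reversible : ∀ {e a} → e ≢ o → a ≢ o → a ≢ e → 2 ≤ ℓ o → Reversible β⟨ s , e ⟩ β⟨ t , a ⟩
  o-down-via-reversible e≢o a≢o a≢e ℓo≥2 = record
    { forth        = o-down-via e≢o a≢o a≢e ℓo≥2
    ; back         = o-up-via e≢o a≢o a≢e ℓo≥2
    ; forth-undone = o-down-via-undone e≢o a≢o a≢e ℓo≥2
    ; back-undone  = o-up-via-undone e≢o a≢o a≢e ℓo≥2
    }

  Defended : VSet G → Vertex → Vertex → Set
  Defended U v w = Σ (Vertex → Vertex) λ φ → IsDefense G U φ v w ×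
    Σ (VSet G) λ W → 𝒰fam k ℓ o W × IsImage G U φ W

  defended-sym : ∀ {U v w} → Defended U v w → Defended U w v
  defended-sym (φ , (injective , reach , hit) , W) = φ , (injective , reach , Sum.swap hit) , W

  defended-resp : ∀ {U U′ v w} → (∀ u → U u ≡ U′ u) → Defended U′ v w → Defended U v w
  defended-resp {U} {U′} U≗U′ (φ , (injective , reach , hit) , W , W∈ , image) =
    φ , ((λ u u′ u∈ u′∈ → injective u u′ (to u∈) (to u′∈)) , (λ u u∈ → reach u (to u∈)) ,
         Sum.map (map₁ from) (map₁ from) hit) ,
    W , W∈ , λ y → ⇔-trans (image y)
      (mk⇔ (λ (u , u∈ , eq) → u , from u∈ , eq) (λ (u , u∈ , eq) → u , to u∈ , eq))
    where
    to : ∀ {u} → U u ≡ true → U′ u ≡ true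
    to {u} = trans (sym (U≗U′ u))
    from : ∀ {u} → U′ u ≡ true → U u ≡ true
    from {u} = trans (U≗U′ u)

  defended-by : ∀ {β β′} (m : Reversible β β′) → 𝒰fam k ℓ o (alternating β′) → ∀ {v w} →
    (alternating β v ≡ true × Move.apply (Reversible.forth m) v ≡ w) ⊎
    (alternating β w ≡ true × Move.apply (Reversible.forth m) w ≡ v) →
    Defended (alternating β) v w
  defended-by m W∈ hit with reversible-legal m
  ... | injective , reach , image = _ , (injective , reach , hit) , _ , W∈ , image

  module _ (x : End k ℓ) {e : Fin k} (e≢o : e ≢ o) where

    private
      A = U⟨ x , e ⟩
      a = proj₁ (avoid-two k≥3 o e)
      a≢o = proj₁ (proj₂ (avoid-two k≥3 o e))
      a≢e = proj₂ (proj₂ (avoid-two k≥3 o e))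

      clash : ∀ {b} → b ≡ true → b ≡ false → ∀ {P : Set} → P
      clash b≡true b≡false = ⊥-elim (true≢false (trans (sym b≡true) b≡false))

    guard-up : ∀ i p → p < ℓ i → A (at′ i p) ≡ true → A (at′ i (suc p)) ≡ false →
      Defended A (at′ i p) (at′ i (suc p))
    guard-up i p p<ℓ v∈ w∉ with i ≟ e | i ≟ o
    ... | yes refl | _ = defended-by (external-up-reversible x e≢o a≢o a≢e (a≢e ∘ sym)) (U⟨⟩∈𝒰 x a≢o)
      (inj₁ (v∈ , move-up-at (steer-next [] (a≢e ∘ sym)) p<ℓ
        λ { refl → clash (alternating-at β⟨ x , e ⟩ e 1 (cong not β-external)) w∉ }))
    ... | no i≢e | no i≢o = defended-by (external-down-reversible x e≢o i≢o i≢e (i≢e ∘ sym)) (U⟨⟩∈𝒰 x i≢o)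
      (inj₁ (v∈ , move-up-at (steer-here i up ((e , down) ∷ [])) p<ℓ λ _ → refl))
    ... | no _   | yes refl = on-o x v∈ w∉
      where
      on-o : ∀ x → U⟨ x , e ⟩ (at′ o p) ≡ true → U⟨ x , e ⟩ (at′ o (suc p)) ≡ false →
        Defended U⟨ x , e ⟩ (at′ o p) (at′ o (suc p))
      on-o s v∈ w∉ = defended-by (o-up-reversible e≢o) (U⟨⟩∈𝒰 t e≢o)
        (inj₁ (v∈ , move-up-at (steer-here o up []) p<ℓ
          λ { refl → clash (alternating-at β⟨ s , e ⟩ o 1 (cong not (β-odd e≢o))) w∉ }))
      on-o t v∈ w∉ = defended-by (reversed (o-down-via-reversible a≢o e≢o (a≢e ∘ sym) ℓo≥2)) (U⟨⟩∈𝒰 s a≢o)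
        (inj₁ (v∈ , move-up-at (steer-here o up ((e , down) ∷ (a , down) ∷ [])) p<ℓ λ _ → refl))
        where
        ℓo≥2 : 2 ≤ ℓ o
        ℓo≥2 with m≤n⇒m<n∨m≡n p<ℓ
        ... | inj₁ p+1<ℓ = ≤-trans (s≤s (s≤s z≤n)) p+1<ℓ
        ... | inj₂ p+1≡ℓ = clash (cong U⟨ t , e ⟩ (trans (cong (at′ o) p+1≡ℓ) (at-ℓ o))) w∉

    guard-down : ∀ i p → p < ℓ i → A (at′ i p) ≡ false → A (at′ i (suc p)) ≡ true →
      Defended A (at′ i p) (at′ i (suc p))
    guard-down i p p<ℓ v∉ w∈ with i ≟ e | i ≟ o
    ... | yes refl | _ = defended-by (external-down-reversible x e≢o a≢o a≢e (a≢e ∘ sym)) (U⟨⟩∈𝒰 x a≢o)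
      (inj₂ (w∈ , move-down-at (steer-next [] (a≢e ∘ sym)) p<ℓ
        λ p+1≡ℓ → clash (subst (λ q → A (at′ e q) ≡ true) (cong pred (sym p+1≡ℓ))
          (alternating-at β⟨ x , e ⟩ e (pred (ℓ e)) (trans (alt-last-even-path e≢o _) (cong not β-external)))) v∉))
    ... | no i≢e | no i≢o = defended-by (external-up-reversible x e≢o i≢o i≢e (i≢e ∘ sym)) (U⟨⟩∈𝒰 x i≢o)
      (inj₂ (w∈ , move-down-at (steer-here i down ((e , up) ∷ [])) p<ℓ λ _ → refl))
    ... | no _   | yes refl = on-o x v∉ w∈
      where
      on-o : ∀ x → U⟨ x , e ⟩ (at′ o p) ≡ false → U⟨ x , e ⟩ (at′ o (suc p)) ≡ true →
        Defended U⟨ x , e ⟩ (at′ o p) (at′ o (suc p))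
      on-o t v∉ w∈ = defended-by (reversed (o-up-reversible e≢o)) (U⟨⟩∈𝒰 s e≢o)
        (inj₂ (w∈ , move-down-at (steer-here o down []) p<ℓ
          λ p+1≡ℓ → clash (subst (λ q → U⟨ t , e ⟩ (at′ o q) ≡ true) (cong pred (sym p+1≡ℓ))
            (alternating-at β⟨ t , e ⟩ o (pred (ℓ o)) (trans (alt-last-o _) (β-odd e≢o)))) v∉))
      on-o s v∉ w∈ = defended-by (o-down-via-reversible e≢o a≢o a≢e ℓo≥2) (U⟨⟩∈𝒰 t a≢o)
        (inj₂ (w∈ , move-down-at (steer-here o down ((e , up) ∷ (a , up) ∷ [])) p<ℓ λ _ → refl))
        where
        p≢0 : p ≢ 0
        p≢0 refl = clash refl v∉
        ℓo≥2 : 2 ≤ ℓ o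
        ℓo≥2 = ≤-trans (s≤s (n≢0⇒n>0 p≢0)) p<ℓ

    defend-edge : ∀ i p → p < ℓ i → Defended A (at′ i p) (at′ i (suc p))
    defend-edge i p p<ℓ = by-membership _ _ refl refl
      where
      v = at′ i p
      w = at′ i (suc p)
      by-membership : ∀ b c → A v ≡ b → A w ≡ c → Defended A v w
      by-membership true true v∈ w∈ with swap-legal G _≟V_ v∈ w∈ (edge i p p<ℓ) (edge⁻ i p p<ℓ)
      ... | injective , reach , image =
        swap G _≟V_ v w , (injective , reach , inj₁ (v∈ , swap-at-v G _≟V_ v w)) , A , U⟨⟩∈𝒰 x e≢o , image
      by-membership true  false v∈ w∉ = guard-up i p p<ℓ v∈ w∉
      by-membership false true  v∉ w∈ = guard-down i p p<ℓ v∉ w∈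
      by-membership false false v∉ w∉ with alternating-cover β⟨ x , e ⟩ v w (edge i p p<ℓ)
      ... | inj₁ v∈ = clash v∈ v∉
      ... | inj₂ w∈ = clash w∈ w∉

  defense : ∀ U → 𝒰fam k ℓ o U → ∀ v w → Adj G v w → Defended U v w
  defense U U∈ v w (i , p , p<ℓ , orientation) with 𝒰⇒U⟨⟩ U U∈ | orientation
  ... | x , e , e≢o , U≗ | inj₁ (refl , refl) = defended-resp U≗ (defend-edge x e≢o i p p<ℓ)
  ... | x , e , e≢o , U≗ | inj₂ (refl , refl) = defended-resp U≗ (defended-sym (defend-edge x e≢o i p p<ℓ))

  private
    e₀ = proj₁ (avoid-two k≥3 o o)
    e₀≢o = proj₁ (proj₂ (avoid-two k≥3 o o))

  vc-number : IsVCNumber G vc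
  vc-number = (alternating (λ _ → true) , alternating-cover _ , card-even-positions) , vc-lower

  𝒰-class : IsEVCClass G (𝒰fam k ℓ o) (suc vc)
  𝒰-class = (U⟨ s , e₀ ⟩ , U⟨⟩∈𝒰 s e₀≢o) , covers , defense
    where
    covers : ∀ U → 𝒰fam k ℓ o U → IsVertexCover G U × card G U ≡ suc vc
    covers U U∈ with 𝒰⇒U⟨⟩ U U∈
    ... | x , e , e≢o , U≗ =
      (λ v w v~w → Sum.map (trans (U≗ v)) (trans (U≗ w)) (alternating-cover β⟨ x , e ⟩ v w v~w)) ,
      trans (count-cong (vertices G) U≗) (card-U⟨⟩ x e≢o)

  -- Defending the edge T — first e₀ leaves a guard on first e₀ before or after the move.
  evc-number : IsEVCNumber G (suc vc)
  evc-number = (𝒰fam k ℓ o , 𝒰-class) , evc-lower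
    where
    evc-lower : ∀ m 𝒰 → IsEVCClass G 𝒰 m → suc vc ≤ m
    evc-lower m 𝒰 ((U , U∈) , covers , defends) with defends U U∈ T (first e₀) (first-adj e₀)
    ... | φ , (_ , _ , inj₁ (T∈U , φT≡first)) , W , W∈ , image =
      subst (suc vc ≤_) (proj₂ (covers W W∈))
        (vc-lower-first W (proj₁ (covers W W∈)) e₀≢o
          (Equivalence.from (image (first e₀)) (T , T∈U , φT≡first)))
    ... | φ , (_ , _ , inj₂ (first∈U , _)) , _ =
      subst (suc vc ≤_) (proj₂ (covers U U∈)) (vc-lower-first U (proj₁ (covers U U∈)) e₀≢o first∈U)

theorem14 : (k : ℕ) → 3 ≤ k → (ℓ : Fin k → ℕ) → (o : Fin k) →
    (∀ i → 1 ≤ ℓ i) → Odd (ℓ o) → (∀ i → i ≢ o → Even (ℓ i)) →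
    Σ ℕ λ c → IsVCNumber (melon k ℓ) c × IsEVCNumber (melon k ℓ) (suc c) ×
      IsEVCClass (melon k ℓ) (𝒰fam k ℓ o) (suc c)
theorem14 k k≥3 ℓ o ℓ≥1 odd-o even = vc , vc-number , evc-number , 𝒰-class
  where open OneOddPath k k≥3 ℓ o ℓ≥1 odd-o even
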